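{- Let $p$ be a prime, $b\ge1$ an integer, $\varGamma(R)$ the zero-divisor graph of $R=\mathbb{Z}_p[x]/\langle x^{2b+1}\rangle$, with $V_i=\{\sum_{k=i}^{2b}a_kx^k:a_i\ne0\}$, $n_i=|V_i|=(p-1)p^{2b-i}$ ($1\le i\le 2b$), $d_i=p^i-1$ for $1\le i\le b$, $d_i=p^i-2$ for $b+1\le i\le 2b$, $D^*=\mathrm{diag}(d_1,\dots,d_{2b})$, and $Q^*$ the $2b\times2b$ matrix with $Q^*_{ii}=0$ for $i\le b$, $Q^*_{ii}=n_i-1$ for $i\ge b+1$, and for $i\ne j$: $Q^*_{ij}=n_j$ if $i+j\ge2b+1$, $0$ otherwise. Then: \begin{enumerate} \item the adjacency spectrum of $\varGamma(R)$ is $\bigcup_{i=1}^{b}\{0^{[n_i-1]}\}\cup\bigcup_{i=b+1}^{2b}\{(-1)^{[n_i-1]}\}\cup\sigma(Q^*)$; \item the signless Laplacian spectrum of $\varGamma(R)$ is $\bigcup_{i=1}^{b}\{(p^i-1)^{[n_i-1]}\}\cup\bigcup_{i=b+1}^{2b}\{(p^i-3)^{[n_i-1]}\}\cup\sigma(D^*+Q^*)$, \end{enumerate} where $\sigma(M)$ denotes the spectrum of a matrix $M$.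
   Context: The zero-divisor graph $\varGamma(R)$ has vertex set the nonzero zero-divisors of $R$, distinct $x,y$ adjacent iff $xy=0$. The signless Laplacian is $D+A$ ($D$ diagonal degree matrix, $A$ adjacency matrix). $\lambda^{[k]}$ denotes eigenvalue $\lambda$ with multiplicity $k$; spectra are multisets. -}

module Defs where

open import Data.Nat as ℕ using (ℕ; zero; suc; _∸_; _≤_)
open import Data.Nat.Divisibility using (_∣_; _∣?_)
open import Data.Integer as ℤ using (ℤ; +_; -_)
open import Data.Fin as Fin using (Fin; toℕ; punchIn)
open import Data.Fin.Properties using (all?)
open import Data.Vec using (Vec; []; _∷_)
open import Data.List as List using (List; []; _∷_; upTo; map)
open import Data.Bool using (Bool; true; false; if_then_else_)
open import Data.Product using (Σ; _×_; ∃)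
open import Relation.Nullary using (¬_; Dec; yes; no)
open import Relation.Nullary.Decidable using (⌊_⌋)
open import Relation.Binary.PropositionalEquality using (_≡_)

-- Polynomials over ℤ as coefficient lists (lowest degree first).

Poly : Set
Poly = List ℤ

coeff : Poly → ℕ → ℤ
coeff []       _       = + 0
coeff (a ∷ _)  zero    = a
coeff (_ ∷ q)  (suc k) = coeff q k

infix 4 _≈P_
_≈P_ : Poly → Poly → Set
p ≈P q = ∀ k → coeff p k ≡ coeff q k

infixl 6 _+P_
_+P_ : Poly → Poly → Poly
[]      +P q       = q
(a ∷ p) +P []      = a ∷ p
(a ∷ p) +P (b ∷ q) = (a ℤ.+ b) ∷ (p +P q)

scaleP : ℤ → Poly → Poly
scaleP c = map (c ℤ.*_)

infixl 7 _*P_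
_*P_ : Poly → Poly → Poly
[]      *P q = []
(a ∷ p) *P q = scaleP a q +P (+ 0 ∷ (p *P q))

negP : Poly → Poly
negP = scaleP (- (+ 1))

constP : ℤ → Poly
constP c = c ∷ []

oneP : Poly
oneP = constP (+ 1)

X : Poly
X = + 0 ∷ + 1 ∷ []

_^P_ : Poly → ℕ → Poly
q ^P zero  = oneP
q ^P suc n = q *P (q ^P n)

prodP : List Poly → Poly
prodP = List.foldr _*P_ oneP

sumFin : ∀ n → (Fin n → Poly) → Poly
sumFin zero    f = []
sumFin (suc n) f = f Fin.zero +P sumFin n (λ i → f (Fin.suc i))

signZ : ℕ → ℤ
signZ zero          = + 1
signZ (suc zero)    = - (+ 1)
signZ (suc (suc k)) = signZ k

detP : ∀ n → (Fin n → Fin n → Poly) → Poly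
detP zero    M = oneP
detP (suc n) M = sumFin (suc n) λ j →
  constP (signZ (toℕ j)) *P M Fin.zero j
    *P detP n (λ r c → M (Fin.suc r) (punchIn j c))

charPoly : ∀ {n} → (Fin n → Fin n → ℤ) → Poly
charPoly {n} M = detP n λ i j →
  (if ⌊ i Fin.≟ j ⌋ then X else []) +P negP (constP (M i j))

-- The ring R = ℤ_p[x]/⟨x^(2b+1)⟩: an element Σ_{k=0}^{2b} a_k x^k is
-- the vector (a_0,…,a_{2b}) of residues a_k ∈ Fin p.

Elem : ℕ → ℕ → Set
Elem p b = Vec (Fin p) (suc (2 ℕ.* b))

coef : ∀ {p m} → Vec (Fin p) m → ℕ → ℕ
coef []      _       = 0
coef (a ∷ _) zero    = toℕ a
coef (_ ∷ v) (suc k) = coef v k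

sumN : List ℕ → ℕ
sumN = List.foldr ℕ._+_ 0

mulCoeff : ∀ {p m} → Vec (Fin p) m → Vec (Fin p) m → ℕ → ℕ
mulCoeff x y k = sumN (map (λ i → coef x i ℕ.* coef y (k ∸ i)) (upTo (suc k)))

-- x·y = 0 in R: all coefficients of degree ≤ 2b vanish mod p
-- (coefficients of degree ≥ 2b+1 are killed by x^(2b+1)).
ProdZero : ∀ p b → Elem p b → Elem p b → Set
ProdZero p b x y = ∀ (k : Fin (suc (2 ℕ.* b))) → p ∣ mulCoeff x y (toℕ k)

prodZero? : ∀ p b (x y : Elem p b) → Dec (ProdZero p b x y)
prodZero? p b x y = all? (λ k → p ∣? mulCoeff x y (toℕ k))

IsZeroElem : ∀ {p b} → Elem p b → Set
IsZeroElem {p} {b} x = ∀ k → coef x k ≡ 0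

NonzeroElem : ∀ {p b} → Elem p b → Set
NonzeroElem {p} {b} x = ¬ IsZeroElem {p} {b} x

IsZeroDivisor : ∀ p b → Elem p b → Set
IsZeroDivisor p b x = ∃ λ (y : Elem p b) → NonzeroElem {p} {b} y × ProdZero p b x y

IsVertex : ∀ p b → Elem p b → Set
IsVertex p b x = NonzeroElem {p} {b} x × IsZeroDivisor p b x

-- Matrices of Γ(R) w.r.t. an enumeration e : Fin N → Elem p b of vertices.

adjMat : ∀ p b {N} → (Fin N → Elem p b) → Fin N → Fin N → ℤ
adjMat p b e i j =
  if ⌊ i Fin.≟ j ⌋ then + 0
  else (if ⌊ prodZero? p b (e i) (e j) ⌋ then + 1 else + 0)

sumZ : ∀ n → (Fin n → ℤ) → ℤ
sumZ zero    f = + 0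
sumZ (suc n) f = f Fin.zero ℤ.+ sumZ n (λ i → f (Fin.suc i))

degMat : ∀ p b {N} → (Fin N → Elem p b) → Fin N → Fin N → ℤ
degMat p b {N} e i j =
  if ⌊ i Fin.≟ j ⌋ then sumZ N (adjMat p b e i) else + 0

signlessLap : ∀ p b {N} → (Fin N → Elem p b) → Fin N → Fin N → ℤ
signlessLap p b e i j = degMat p b e i j ℤ.+ adjMat p b e i j

nSize : ℕ → ℕ → ℕ → ℕ
nSize p b i = (p ∸ 1) ℕ.* p ℕ.^ (2 ℕ.* b ∸ i)

dDeg : ℕ → ℕ → ℕ → ℤ
dDeg p b i = if ⌊ i ℕ.≤? b ⌋ then + (p ℕ.^ i) ℤ.- + 1 else + (p ℕ.^ i) ℤ.- + 2

-- index of Fin (2b) element as 1..2b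
ix : ∀ {b} → Fin (2 ℕ.* b) → ℕ
ix i = suc (toℕ i)

Qstar : ∀ p b → Fin (2 ℕ.* b) → Fin (2 ℕ.* b) → ℤ
Qstar p b i j =
  if ⌊ i Fin.≟ j ⌋
  then (if ⌊ ix {b} i ℕ.≤? b ⌋ then + 0 else + (nSize p b (ix {b} i)) ℤ.- + 1)
  else (if ⌊ suc (2 ℕ.* b) ℕ.≤? ix {b} i ℕ.+ ix {b} j ⌋ then + (nSize p b (ix {b} j)) else + 0)

Dstar : ∀ p b → Fin (2 ℕ.* b) → Fin (2 ℕ.* b) → ℤ
Dstar p b i j = if ⌊ i Fin.≟ j ⌋ then dDeg p b (ix {b} i) else + 0

DQstar : ∀ p b → Fin (2 ℕ.* b) → Fin (2 ℕ.* b) → ℤ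
DQstar p b i j = Dstar p b i j ℤ.+ Qstar p b i j

range : ℕ → ℕ → List ℕ
range lo hi = map (lo ℕ.+_) (upTo (suc hi ∸ lo))

linPow : ℤ → ℕ → Poly
linPow λ₀ k = (X +P negP (constP λ₀)) ^P k

-- characteristic polynomial of the claimed adjacency spectrum
-- ⋃_{i≤b} {0^[n_i−1]} ∪ ⋃_{i>b} {(−1)^[n_i−1]} ∪ σ(Q*)
adjSpecPoly : ℕ → ℕ → Poly
adjSpecPoly p b =
  prodP (map (λ i → linPow (+ 0) (nSize p b i ∸ 1)) (range 1 b))
  *P prodP (map (λ i → linPow (- (+ 1)) (nSize p b i ∸ 1)) (range (suc b) (2 ℕ.* b)))
  *P charPoly (Qstar p b)

-- characteristic polynomial of the claimed signless Laplacian spectrum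
-- ⋃_{i≤b} {(p^i−1)^[n_i−1]} ∪ ⋃_{i>b} {(p^i−3)^[n_i−1]} ∪ σ(D*+Q*)
qSpecPoly : ℕ → ℕ → Poly
qSpecPoly p b =
  prodP (map (λ i → linPow (+ (p ℕ.^ i) ℤ.- + 1) (nSize p b i ∸ 1)) (range 1 b))
  *P prodP (map (λ i → linPow (+ (p ℕ.^ i) ℤ.- + 3) (nSize p b i ∸ 1)) (range (suc b) (2 ℕ.* b)))
  *P charPoly (DQstar p b)

-- An element of ℤ_p[x]/⟨x^(2b+1)⟩ is a nonzero zero-divisor iff its valuation (the lowest
-- degree with a nonzero coefficient) lies in [1, 2b], and, p being prime, two such elements
-- multiply to 0 iff their valuations add up to at least 2b + 1. So, with V_i the vertices of
-- valuation i, both A and D + A are constant on every block V_i × V_j off the diagonal, with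
-- value B_ij, and on the diagonal of every V_i, with value e_i. In X I - M two rows of one
-- class V_i differ by d_i (e_r - e_s), where d_i = X - (e_i - B_ii); this splits off a factor
-- d_i and merges the two rows and their columns into one. By induction
--   det (X I - M) = ∏_i d_i ^ (|V_i| - 1) · det (X I - Q),   Q_ij = δ_ij (e_i - B_ii) + B_ij |V_j|.
-- Counting vectors by valuation gives |V_i| = (p - 1) p^(2b-i) and the degree p^i - 1 or p^i - 2
-- of a vertex in V_i, which turn Q into Q* resp. D* + Q*.

module Submission where

open import Defs
open import Data.Nat using (ℕ; _≤_)
open import Data.Nat.Primality using (Prime)
open import Data.Fin using (Fin)
open import Data.Product using (_×_; ∃; _,_)
open import Function.Definitions using (Injective)
open import Relation.Binary.PropositionalEquality using (_≡_)
open import Algebra.Bundles using (CommutativeRing)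

module Indicator where

  open import Data.Nat using (ℕ; zero; suc; _+_; _*_)
  import Data.Nat.Properties as ℕ
  open import Data.Fin using (Fin; zero; suc; _≟_)
  open import Data.Fin.Properties using (suc-injective)
  open import Data.Empty using (⊥-elim)
  open import Function using (_∘_)
  open import Relation.Nullary using (Dec; yes; no; ¬_; ¬?)
  open import Relation.Binary.PropositionalEquality

  open import Algebra.Properties.CommutativeMonoid.Sum ℕ.+-0-commutativeMonoid public
    using (sum; sum-cong-≗; ∑-comm; ∑-distrib-+; sum-permute)
  open import Algebra.Properties.Semiring.Sum ℕ.+-*-semiring using (*-distribʳ-sum)

  𝟙 : ∀ {p} {P : Set p} → Dec P → ℕ
  𝟙 (yes _) = 1
  𝟙 (no _)  = 0

  𝟙-yes : ∀ {p} {P : Set p} (d : Dec P) → P → 𝟙 d ≡ 1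
  𝟙-yes (yes _) _  = refl
  𝟙-yes (no ¬p) p = ⊥-elim (¬p p)

  𝟙-no : ∀ {p} {P : Set p} (d : Dec P) → ¬ P → 𝟙 d ≡ 0
  𝟙-no (yes p) ¬p = ⊥-elim (¬p p)
  𝟙-no (no _)  _  = refl

  𝟙-cong : ∀ {p q} {P : Set p} {Q : Set q} → (P → Q) → (Q → P) → (d : Dec P) (e : Dec Q) → 𝟙 d ≡ 𝟙 e
  𝟙-cong P→Q Q→P (yes p) e = sym (𝟙-yes e (P→Q p))
  𝟙-cong P→Q Q→P (no ¬p) e = sym (𝟙-no e (¬p ∘ Q→P))

  𝟙-suc≟suc : ∀ {n} (i j : Fin n) → 𝟙 (suc i ≟ suc j) ≡ 𝟙 (i ≟ j)
  𝟙-suc≟suc i j = 𝟙-cong suc-injective (cong suc) (suc i ≟ suc j) (i ≟ j)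

  ∑-zero : ∀ {n} (f : Fin n → ℕ) → (∀ j → f j ≡ 0) → sum f ≡ 0
  ∑-zero {zero}  f _   = refl
  ∑-zero {suc n} f f≡0 = cong₂ _+_ (f≡0 zero) (∑-zero (f ∘ suc) (f≡0 ∘ suc))

  ∑-const : ∀ n c → sum {n} (λ _ → c) ≡ n * c
  ∑-const zero    c = refl
  ∑-const (suc n) c = cong (c +_) (∑-const n c)

  ∑-𝟙≟-* : ∀ {n} (i : Fin n) (h : Fin n → ℕ) → sum (λ j → 𝟙 (j ≟ i) * h j) ≡ h i
  ∑-𝟙≟-* {suc n} zero h = begin
    1 * h zero + sum (λ j → 𝟙 (suc j ≟ zero) * h (suc j))
      ≡⟨ cong (1 * h zero +_) (∑-zero _ λ j → cong (_* h (suc j)) (𝟙-no (suc j ≟ zero) λ ())) ⟩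
    1 * h zero + 0
      ≡⟨ ℕ.+-identityʳ _ ⟩
    1 * h zero
      ≡⟨ ℕ.*-identityˡ _ ⟩
    h zero ∎
    where open ≡-Reasoning
  ∑-𝟙≟-* {suc n} (suc i) h = begin
    0 * h zero + sum (λ j → 𝟙 (suc j ≟ suc i) * h (suc j))  ≡⟨ sum-cong-≗ (λ j → cong (_* h (suc j)) (𝟙-suc≟suc j i)) ⟩
    sum (λ j → 𝟙 (j ≟ i) * h (suc j))                       ≡⟨ ∑-𝟙≟-* i (h ∘ suc) ⟩
    h (suc i)                                               ∎
    where open ≡-Reasoning

  ∑-𝟙≟ : ∀ {n} (i : Fin n) → sum (λ j → 𝟙 (j ≟ i)) ≡ 1
  ∑-𝟙≟ i = trans (sum-cong-≗ λ j → sym (ℕ.*-identityʳ (𝟙 (j ≟ i)))) (∑-𝟙≟-* i (λ _ → 1))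

  ∑-𝟙≟-*-sym : ∀ {n} (i : Fin n) (h : Fin n → ℕ) → sum (λ j → 𝟙 (i ≟ j) * h j) ≡ h i
  ∑-𝟙≟-*-sym i h = trans (sum-cong-≗ λ j → cong (_* h j) (𝟙-cong sym sym (i ≟ j) (j ≟ i))) (∑-𝟙≟-* i h)

  ∑-regroup : ∀ {m n} (c : Fin m → Fin n) (h : Fin n → ℕ) →
    sum (λ z → h (c z)) ≡ sum (λ k → h k * sum (λ z → 𝟙 (c z ≟ k)))
  ∑-regroup {m} {n} c h = begin
    sum (λ z → h (c z))                        ≡⟨ sum-cong-≗ (λ z → sym (∑-𝟙≟-*-sym (c z) h)) ⟩
    sum (λ z → sum (λ k → 𝟙 (c z ≟ k) * h k))  ≡⟨ ∑-comm (λ z k → 𝟙 (c z ≟ k) * h k) ⟩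
    sum (λ k → sum (λ z → 𝟙 (c z ≟ k) * h k))  ≡⟨ sum-cong-≗ (λ k → sym (*-distribʳ-sum (h k) λ z → 𝟙 (c z ≟ k))) ⟩
    sum (λ k → sum (λ z → 𝟙 (c z ≟ k)) * h k)  ≡⟨ sum-cong-≗ (λ k → ℕ.*-comm _ (h k)) ⟩
    sum (λ k → h k * sum (λ z → 𝟙 (c z ≟ k)))  ∎
    where open ≡-Reasoning

  ∑-offDiagonal : ∀ {n} (i : Fin n) (h : Fin n → ℕ) → sum (λ j → 𝟙 (¬? (i ≟ j)) * h j) + h i ≡ sum h
  ∑-offDiagonal i h = begin
    sum (λ j → 𝟙 (¬? (i ≟ j)) * h j) + h i                          ≡⟨ cong (sum (λ j → 𝟙 (¬? (i ≟ j)) * h j) +_) (∑-𝟙≟-*-sym i h) ⟨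
    sum (λ j → 𝟙 (¬? (i ≟ j)) * h j) + sum (λ j → 𝟙 (i ≟ j) * h j)  ≡⟨ ∑-distrib-+ (λ j → 𝟙 (¬? (i ≟ j)) * h j) _ ⟨
    sum (λ j → 𝟙 (¬? (i ≟ j)) * h j + 𝟙 (i ≟ j) * h j)              ≡⟨ sum-cong-≗ (λ j → split (i ≟ j) (h j)) ⟩
    sum h                                                           ∎
    where
    open ≡-Reasoning
    split : ∀ {p} {P : Set p} (d : Dec P) x → 𝟙 (¬? d) * x + 𝟙 d * x ≡ x
    split (yes _) x = ℕ.+-identityʳ x
    split (no _)  x = trans (ℕ.+-identityʳ _) (ℕ.+-identityʳ x)


module PolynomialRing where

  open import Data.Nat using (zero; suc)
  open import Data.Integer using (ℤ; +_; -[1+_]; -_; _+_; _*_; _-_)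
  import Data.Integer.Properties as ℤ
  open import Data.Integer.Solver using (module +-*-Solver)
  open import Data.List using ([]; _∷_)
  open import Data.Product using (_,_)
  open import Algebra.Structures using (IsCommutativeRing)
  open import Relation.Binary.Structures using (IsEquivalence)
  open import Relation.Binary.PropositionalEquality
  open import Relation.Binary.Bundles using (Setoid)
  import Relation.Binary.Reasoning.Setoid
  open import Level using (0ℓ)

  open +-*-Solver

  coeff-+P : ∀ p q k → coeff (p +P q) k ≡ coeff p k + coeff q k
  coeff-+P []      q       k       = sym (ℤ.+-identityˡ _)
  coeff-+P (a ∷ p) []      k       = sym (ℤ.+-identityʳ _)
  coeff-+P (a ∷ p) (b ∷ q) zero    = refl
  coeff-+P (a ∷ p) (b ∷ q) (suc k) = coeff-+P p q k

  coeff-scaleP : ∀ c p k → coeff (scaleP c p) k ≡ c * coeff p k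
  coeff-scaleP c []      k       = sym (ℤ.*-zeroʳ c)
  coeff-scaleP c (a ∷ p) zero    = refl
  coeff-scaleP c (a ∷ p) (suc k) = coeff-scaleP c p k

  -- A record wrapper around the pointwise relation _≈P_, so that the
  -- polynomials stay inferable from a proof of equality.
  infix 4 _≋_
  record _≋_ (p q : Poly) : Set where
    constructor coeffwise
    field coeff-≡ : p ≈P q
  open _≋_ public

  ≋-refl : ∀ {p} → p ≋ p
  ≋-refl = coeffwise λ _ → refl

  ≋-sym : ∀ {p q} → p ≋ q → q ≋ p
  ≋-sym (coeffwise e) = coeffwise λ k → sym (e k)

  ≋-trans : ∀ {p q r} → p ≋ q → q ≋ r → p ≋ r
  ≋-trans (coeffwise e) (coeffwise f) = coeffwise λ k → trans (e k) (f k)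

  ≋-reflexive : ∀ {p q} → p ≡ q → p ≋ q
  ≋-reflexive refl = ≋-refl

  ≋-isEquivalence : IsEquivalence _≋_
  ≋-isEquivalence = record { refl = ≋-refl ; sym = ≋-sym ; trans = ≋-trans }

  ≋-setoid : Setoid 0ℓ 0ℓ
  ≋-setoid = record { isEquivalence = ≋-isEquivalence }

  module ≋-Reasoning = Relation.Binary.Reasoning.Setoid ≋-setoid

  ∷-cong : ∀ {a b p q} → a ≡ b → p ≋ q → a ∷ p ≋ b ∷ q
  ∷-cong e (coeffwise f) = coeffwise λ { zero → e ; (suc k) → f k }

  ∷-injectiveʳ : ∀ {a b p q} → a ∷ p ≋ b ∷ q → p ≋ q
  ∷-injectiveʳ (coeffwise e) = coeffwise λ k → e (suc k)

  ∷≋[]⇒≋[] : ∀ {a p} → a ∷ p ≋ [] → p ≋ []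
  ∷≋[]⇒≋[] (coeffwise e) = coeffwise λ k → e (suc k)

  0∷[]≋[] : + 0 ∷ [] ≋ []
  0∷[]≋[] = coeffwise λ { zero → refl ; (suc k) → refl }

  +P-cong : ∀ {p p′ q q′} → p ≋ p′ → q ≋ q′ → p +P q ≋ p′ +P q′
  +P-cong {p} {p′} {q} {q′} (coeffwise e) (coeffwise f) = coeffwise λ k → begin
    coeff (p +P q) k         ≡⟨ coeff-+P p q k ⟩
    coeff p k + coeff q k    ≡⟨ cong₂ _+_ (e k) (f k) ⟩
    coeff p′ k + coeff q′ k  ≡⟨ coeff-+P p′ q′ k ⟨
    coeff (p′ +P q′) k       ∎
    where open ≡-Reasoning

  +P-comm : ∀ p q → p +P q ≋ q +P p
  +P-comm p q = coeffwise λ k →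
    trans (coeff-+P p q k) (trans (ℤ.+-comm (coeff p k) _) (sym (coeff-+P q p k)))

  +P-assoc : ∀ p q r → (p +P q) +P r ≋ p +P (q +P r)
  +P-assoc p q r = coeffwise λ k → begin
    coeff ((p +P q) +P r) k              ≡⟨ coeff-+P (p +P q) r k ⟩
    coeff (p +P q) k + coeff r k         ≡⟨ cong (_+ coeff r k) (coeff-+P p q k) ⟩
    coeff p k + coeff q k + coeff r k    ≡⟨ ℤ.+-assoc (coeff p k) _ _ ⟩
    coeff p k + (coeff q k + coeff r k)  ≡⟨ cong (_+_ (coeff p k)) (coeff-+P q r k) ⟨
    coeff p k + coeff (q +P r) k         ≡⟨ coeff-+P p (q +P r) k ⟨
    coeff (p +P (q +P r)) k              ∎
    where open ≡-Reasoning

  +P-identityʳ : ∀ p → p +P [] ≋ p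
  +P-identityʳ p = coeffwise λ k → trans (coeff-+P p [] k) (ℤ.+-identityʳ _)

  negP-inverseʳ : ∀ p → p +P negP p ≋ []
  negP-inverseʳ p = coeffwise λ k → begin
    coeff (p +P negP p) k            ≡⟨ coeff-+P p (negP p) k ⟩
    coeff p k + coeff (negP p) k     ≡⟨ cong (_+_ (coeff p k)) (coeff-scaleP (- + 1) p k) ⟩
    coeff p k + (- + 1) * coeff p k  ≡⟨ cong (_+_ (coeff p k)) (ℤ.-1*i≡-i (coeff p k)) ⟩
    coeff p k - coeff p k            ≡⟨ ℤ.+-inverseʳ (coeff p k) ⟩
    + 0                              ∎
    where open ≡-Reasoning

  scaleP-cong : ∀ c {p q} → p ≋ q → scaleP c p ≋ scaleP c q
  scaleP-cong c {p} {q} (coeffwise e) = coeffwise λ k →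
    trans (coeff-scaleP c p k) (trans (cong (_*_ c) (e k)) (sym (coeff-scaleP c q k)))

  scaleP-distribˡ : ∀ c p q → scaleP c (p +P q) ≋ scaleP c p +P scaleP c q
  scaleP-distribˡ c p q = coeffwise λ k → begin
    coeff (scaleP c (p +P q)) k                  ≡⟨ coeff-scaleP c (p +P q) k ⟩
    c * coeff (p +P q) k                         ≡⟨ cong (_*_ c) (coeff-+P p q k) ⟩
    c * (coeff p k + coeff q k)                  ≡⟨ ℤ.*-distribˡ-+ c (coeff p k) _ ⟩
    c * coeff p k + c * coeff q k                ≡⟨ cong₂ _+_ (coeff-scaleP c p k) (coeff-scaleP c q k) ⟨
    coeff (scaleP c p) k + coeff (scaleP c q) k  ≡⟨ coeff-+P (scaleP c p) (scaleP c q) k ⟨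
    coeff (scaleP c p +P scaleP c q) k           ∎
    where open ≡-Reasoning

  scaleP-distribʳ : ∀ a b p → scaleP (a + b) p ≋ scaleP a p +P scaleP b p
  scaleP-distribʳ a b p = coeffwise λ k → begin
    coeff (scaleP (a + b) p) k                   ≡⟨ coeff-scaleP (a + b) p k ⟩
    (a + b) * coeff p k                          ≡⟨ ℤ.*-distribʳ-+ (coeff p k) a b ⟩
    a * coeff p k + b * coeff p k                ≡⟨ cong₂ _+_ (coeff-scaleP a p k) (coeff-scaleP b p k) ⟨
    coeff (scaleP a p) k + coeff (scaleP b p) k  ≡⟨ coeff-+P (scaleP a p) (scaleP b p) k ⟨
    coeff (scaleP a p +P scaleP b p) k           ∎
    where open ≡-Reasoning

  scaleP-assoc : ∀ a b p → scaleP (a * b) p ≋ scaleP a (scaleP b p)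
  scaleP-assoc a b p = coeffwise λ k → begin
    coeff (scaleP (a * b) p) k       ≡⟨ coeff-scaleP (a * b) p k ⟩
    a * b * coeff p k                ≡⟨ ℤ.*-assoc a b (coeff p k) ⟩
    a * (b * coeff p k)              ≡⟨ cong (_*_ a) (coeff-scaleP b p k) ⟨
    a * coeff (scaleP b p) k         ≡⟨ coeff-scaleP a (scaleP b p) k ⟨
    coeff (scaleP a (scaleP b p)) k  ∎
    where open ≡-Reasoning

  scaleP-zero : ∀ p → scaleP (+ 0) p ≋ []
  scaleP-zero p = coeffwise λ k → coeff-scaleP (+ 0) p k

  scaleP-identity : ∀ p → scaleP (+ 1) p ≋ p
  scaleP-identity p = coeffwise λ k → trans (coeff-scaleP (+ 1) p k) (ℤ.*-identityˡ _)

  +P-interchange : ∀ p q r s → (p +P q) +P (r +P s) ≋ (p +P r) +P (q +P s)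
  +P-interchange p q r s = coeffwise λ k → begin
    coeff ((p +P q) +P (r +P s)) k
      ≡⟨ expand p q r s k ⟩
    (coeff p k + coeff q k) + (coeff r k + coeff s k)
      ≡⟨ solve 4 (λ x y z w → (x :+ y) :+ (z :+ w) := (x :+ z) :+ (y :+ w)) refl (coeff p k) _ _ _ ⟩
    (coeff p k + coeff r k) + (coeff q k + coeff s k)
      ≡⟨ expand p r q s k ⟨
    coeff ((p +P r) +P (q +P s)) k ∎
    where
    open ≡-Reasoning
    expand : ∀ p q r s k → coeff ((p +P q) +P (r +P s)) k ≡ (coeff p k + coeff q k) + (coeff r k + coeff s k)
    expand p q r s k = trans (coeff-+P (p +P q) (r +P s) k) (cong₂ _+_ (coeff-+P p q k) (coeff-+P r s k))

  +P-congʳ : ∀ p {q r} → q ≋ r → p +P q ≋ p +P r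
  +P-congʳ p = +P-cong (≋-refl {p})

  *P-zeroʳ : ∀ p → p *P [] ≋ []
  *P-zeroʳ []      = ≋-refl
  *P-zeroʳ (a ∷ p) = ≋-trans (∷-cong refl (*P-zeroʳ p)) 0∷[]≋[]

  *P-zeroˡ : ∀ {p} r → p ≋ [] → p *P r ≋ []
  *P-zeroˡ {[]}    r _ = ≋-refl
  *P-zeroˡ {a ∷ p} r e = begin
    scaleP a r +P (+ 0 ∷ p *P r)
      ≈⟨ +P-cong (≋-trans (scaleP-congˡ (coeff-≡ e zero)) (scaleP-zero r)) (∷-cong refl (*P-zeroˡ r (∷≋[]⇒≋[] e))) ⟩
    + 0 ∷ []
      ≈⟨ 0∷[]≋[] ⟩
    [] ∎
    where
    open ≋-Reasoning
    scaleP-congˡ : ∀ {c d} → c ≡ d → scaleP c r ≋ scaleP d r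
    scaleP-congˡ refl = ≋-refl

  *P-congˡ : ∀ {p q} r → p ≋ q → p *P r ≋ q *P r
  *P-congˡ {[]}    {[]}    r e = ≋-refl
  *P-congˡ {[]}    {b ∷ q} r e = ≋-sym (*P-zeroˡ r (≋-sym e))
  *P-congˡ {a ∷ p} {[]}    r e = *P-zeroˡ r e
  *P-congˡ {a ∷ p} {b ∷ q} r e with refl ← coeff-≡ e zero =
    +P-congʳ (scaleP a r) (∷-cong refl (*P-congˡ r (∷-injectiveʳ e)))

  *P-distribʳ : ∀ p q r → (p +P q) *P r ≋ p *P r +P q *P r
  *P-distribʳ []      q       r = ≋-refl
  *P-distribʳ (a ∷ p) []      r = ≋-sym (+P-identityʳ _)
  *P-distribʳ (a ∷ p) (b ∷ q) r = begin
    scaleP (a + b) r +P (+ 0 ∷ (p +P q) *P r)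
      ≈⟨ +P-cong (scaleP-distribʳ a b r) (∷-cong refl (*P-distribʳ p q r)) ⟩
    (scaleP a r +P scaleP b r) +P ((+ 0 ∷ p *P r) +P (+ 0 ∷ q *P r))
      ≈⟨ +P-interchange (scaleP a r) _ _ _ ⟩
    (scaleP a r +P (+ 0 ∷ p *P r)) +P (scaleP b r +P (+ 0 ∷ q *P r)) ∎
    where open ≋-Reasoning

  *P-∷ʳ : ∀ p b q → p *P (b ∷ q) ≋ scaleP b p +P (+ 0 ∷ p *P q)
  *P-∷ʳ []      b q = ≋-sym 0∷[]≋[]
  *P-∷ʳ (a ∷ p) b q = begin
    (a * b + + 0) ∷ (scaleP a q +P p *P (b ∷ q))
      ≈⟨ ∷-cong (cong (_+ + 0) (ℤ.*-comm a b)) (+P-congʳ (scaleP a q) (*P-∷ʳ p b q)) ⟩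
    (b * a + + 0) ∷ (scaleP a q +P (scaleP b p +P (+ 0 ∷ p *P q)))
      ≈⟨ ∷-cong refl (+P-left-comm (scaleP a q) (scaleP b p) _) ⟩
    (b * a + + 0) ∷ (scaleP b p +P (scaleP a q +P (+ 0 ∷ p *P q))) ∎
    where
    open ≋-Reasoning
    +P-left-comm : ∀ x y z → x +P (y +P z) ≋ y +P (x +P z)
    +P-left-comm x y z = ≋-trans (≋-sym (+P-assoc x y z))
      (≋-trans (+P-cong (+P-comm x y) (≋-refl {z})) (+P-assoc y x z))

  *P-comm : ∀ p q → p *P q ≋ q *P p
  *P-comm []      q = ≋-sym (*P-zeroʳ q)
  *P-comm (a ∷ p) q = ≋-trans (+P-congʳ (scaleP a q) (∷-cong refl (*P-comm p q))) (≋-sym (*P-∷ʳ q a p))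

  *P-congʳ : ∀ p {q r} → q ≋ r → p *P q ≋ p *P r
  *P-congʳ p {q} {r} e = ≋-trans (*P-comm p q) (≋-trans (*P-congˡ p e) (*P-comm r p))

  scaleP-*P : ∀ a q r → scaleP a q *P r ≋ scaleP a (q *P r)
  scaleP-*P a []      r = ≋-refl
  scaleP-*P a (b ∷ q) r = begin
    scaleP (a * b) r +P (+ 0 ∷ scaleP a q *P r)
      ≈⟨ +P-cong (scaleP-assoc a b r) (∷-cong (sym (ℤ.*-zeroʳ a)) (scaleP-*P a q r)) ⟩
    scaleP a (scaleP b r) +P scaleP a (+ 0 ∷ q *P r)
      ≈⟨ scaleP-distribˡ a (scaleP b r) _ ⟨
    scaleP a (scaleP b r +P (+ 0 ∷ q *P r)) ∎
    where open ≋-Reasoning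

  0∷-*P : ∀ p r → (+ 0 ∷ p) *P r ≋ + 0 ∷ p *P r
  0∷-*P p r = +P-cong (scaleP-zero r) (≋-refl {+ 0 ∷ p *P r})

  *P-assoc : ∀ p q r → (p *P q) *P r ≋ p *P (q *P r)
  *P-assoc []      q r = ≋-refl
  *P-assoc (a ∷ p) q r = begin
    (scaleP a q +P (+ 0 ∷ p *P q)) *P r
      ≈⟨ *P-distribʳ (scaleP a q) _ r ⟩
    scaleP a q *P r +P (+ 0 ∷ p *P q) *P r
      ≈⟨ +P-cong (scaleP-*P a q r) (≋-trans (0∷-*P (p *P q) r) (∷-cong refl (*P-assoc p q r))) ⟩
    scaleP a (q *P r) +P (+ 0 ∷ p *P (q *P r)) ∎
    where open ≋-Reasoning

  *P-identityˡ : ∀ p → oneP *P p ≋ p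
  *P-identityˡ p = ≋-trans (+P-cong (scaleP-identity p) 0∷[]≋[]) (+P-identityʳ p)

  *P-identityʳ : ∀ p → p *P oneP ≋ p
  *P-identityʳ p = ≋-trans (*P-comm p oneP) (*P-identityˡ p)

  Poly-isCommutativeRing : IsCommutativeRing _≋_ _+P_ _*P_ negP [] oneP
  Poly-isCommutativeRing = record
    { isRing = record
      { +-isAbelianGroup = record
        { isGroup = record
          { isMonoid = record
            { isSemigroup = record
              { isMagma = record { isEquivalence = ≋-isEquivalence ; ∙-cong = +P-cong }
              ; assoc = +P-assoc }
            ; identity = (λ _ → ≋-refl) , +P-identityʳ }
          ; inverse = (λ p → ≋-trans (+P-comm (negP p) p) (negP-inverseʳ p)) , negP-inverseʳ
          ; ⁻¹-cong = scaleP-cong (- + 1) }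
        ; comm = +P-comm }
      ; *-cong = λ {_} {q} {r} e f → ≋-trans (*P-congˡ r e) (*P-congʳ q f)
      ; *-assoc = *P-assoc
      ; *-identity = *P-identityˡ , *P-identityʳ
      ; distrib = (λ p q r → ≋-trans (*P-comm p (q +P r)) (≋-trans (*P-distribʳ q r p) (+P-cong (*P-comm q p) (*P-comm r p))))
                , (λ r p q → *P-distribʳ p q r) }
    ; *-comm = *P-comm }

  Poly-commutativeRing : CommutativeRing 0ℓ 0ℓ
  Poly-commutativeRing = record { isCommutativeRing = Poly-isCommutativeRing }

  +P-double≋[]⇒≋[] : ∀ p → p +P p ≋ [] → p ≋ []
  +P-double≋[]⇒≋[] p (coeffwise e) = coeffwise λ k → double≡0⇒≡0 (coeff p k) (trans (sym (coeff-+P p p k)) (e k))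
    where
    double≡0⇒≡0 : ∀ x → x + x ≡ + 0 → x ≡ + 0
    double≡0⇒≡0 (+ zero)   _ = refl
    double≡0⇒≡0 (+ suc n)  ()
    double≡0⇒≡0 -[1+ n ]   ()


module Determinant {c ℓ} (R : CommutativeRing c ℓ) where

  open import Data.Nat using (ℕ; zero; suc)
  open import Data.Fin using (Fin; zero; suc; toℕ; punchIn; inject₁; _≟_)
  open import Data.Fin.Properties using (punchInᵢ≢i; toℕ-inject₁)
  open import Data.Maybe using (nothing)
  open import Data.Product using (_×_; _,_; proj₁; proj₂)
  open import Data.List using (List; []; _∷_; _++_; map)
  open import Data.Fin.Permutation using (Permutation′; _⟨$⟩ʳ_)
  open import Data.Fin.Permutation.Components using (transpose)
  open import Data.Fin.Permutation.Transposition.List using (TranspositionList; eval; decompose; eval-decompose)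
  open import Level using (_⊔_)
  open import Data.Empty using (⊥-elim)
  open import Function using (id; _∘_)
  open import Relation.Binary.PropositionalEquality as ≡ using (_≡_; _≢_)
  open import Relation.Binary.Definitions using (WeaklyDecidable)
  open import Relation.Nullary using (Dec; yes; no; ¬_; ¬?)

  open CommutativeRing R hiding (zero)
  open import Algebra.Properties.CommutativeMonoid.Sum +-commutativeMonoid
    using (sum; sum-cong-≋; sum-replicate-zero; sum-remove; ∑-comm; ∑-distrib-+)
  open import Algebra.Properties.Semiring.Sum semiring using (*-distribˡ-sum)
  open import Algebra.Properties.Ring ring using (-‿distribˡ-*; -‿distribʳ-*; -‿involutive; -0#≈0#; -1*x≈-x)
  open import Algebra.Solver.Ring.AlmostCommutativeRing
    using (AlmostCommutativeRing; fromCommutativeRing; -raw-almostCommutative⟶; Induced-equivalence)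
  import Algebra.Solver.Ring
  open import Relation.Binary.Reasoning.Setoid setoid

  private
    ACR : AlmostCommutativeRing c ℓ
    ACR = fromCommutativeRing R

    noEquality : WeaklyDecidable (Induced-equivalence (-raw-almostCommutative⟶ ACR))
    noEquality _ _ = nothing

  module RingSolver = Algebra.Solver.Ring (AlmostCommutativeRing.rawRing ACR) ACR (-raw-almostCommutative⟶ ACR) noEquality

  Matrix : ℕ → Set c
  Matrix n = Fin n → Fin n → Carrier

  sign : ℕ → Carrier
  sign zero          = 1#
  sign (suc zero)    = - 1#
  sign (suc (suc k)) = sign k

  minor : ∀ {n} → Matrix (suc n) → Fin (suc n) → Matrix n
  minor M j r c = M (suc r) (punchIn j c)

  det : ∀ n → Matrix n → Carrier
  laplaceTerm : ∀ {n} → Matrix (suc n) → Fin (suc n) → Carrier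

  det zero    M = 1#
  det (suc n) M = sum (laplaceTerm M)

  laplaceTerm {n} M j = sign (toℕ j) * M zero j * det n (minor M j)

  det-cong : ∀ n {M N : Matrix n} → (∀ i j → M i j ≈ N i j) → det n M ≈ det n N
  det-cong zero    e = refl
  det-cong (suc n) e = sum-cong-≋ λ j →
    *-cong (*-cong (refl {sign (toℕ j)}) (e zero j)) (det-cong n λ r c → e (suc r) (punchIn j c))

  sign-suc : ∀ k → sign (suc k) ≈ - sign k
  sign-suc zero          = refl
  sign-suc (suc zero)    = sym (-‿involutive 1#)
  sign-suc (suc (suc k)) = sign-suc k

  -‿*-‿ : ∀ x y → - x * - y ≈ x * y
  -‿*-‿ x y = trans (sym (-‿distribˡ-* x (- y))) (trans (-‿cong (sym (-‿distribʳ-* x y))) (-‿involutive _))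

  ∑-zero : ∀ {n} (f : Fin n → Carrier) → (∀ j → f j ≈ 0#) → sum f ≈ 0#
  ∑-zero {n} f e = trans (sum-cong-≋ e) (sum-replicate-zero n)

  ∑-neg : ∀ {n} (f : Fin n → Carrier) → sum (λ j → - f j) ≈ - sum f
  ∑-neg f = begin
    sum (λ j → - f j)       ≈⟨ sum-cong-≋ (λ j → sym (-1*x≈-x (f j))) ⟩
    sum (λ j → - 1# * f j)  ≈⟨ *-distribˡ-sum (- 1#) f ⟨
    - 1# * sum f            ≈⟨ -1*x≈-x (sum f) ⟩
    - sum f                 ∎

  when : ∀ {p} {P : Set p} → Dec P → Carrier → Carrier
  when (yes _) x = x
  when (no _)  _ = 0#

  when-yes : ∀ {p} {P : Set p} (d : Dec P) x → P → when d x ≈ x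
  when-yes (yes _) x _  = refl
  when-yes (no ¬p) x p = ⊥-elim (¬p p)

  when-no : ∀ {p} {P : Set p} (d : Dec P) x → ¬ P → when d x ≈ 0#
  when-no (yes p) x ¬p = ⊥-elim (¬p p)
  when-no (no _)  x _  = refl

  when-cong : ∀ {p q} {P : Set p} {Q : Set q} → (P → Q) → (Q → P) → (d : Dec P) (e : Dec Q) → ∀ x → when d x ≈ when e x
  when-cong P→Q Q→P (yes p) e x = sym (when-yes e x (P→Q p))
  when-cong P→Q Q→P (no ¬p) e x = sym (when-no e x (¬p ∘ Q→P))

  δ : ∀ {n} → Fin n → Fin n → Carrier → Carrier
  δ i j = when (i ≟ j)

  δ-≡ : ∀ {n} (i : Fin n) x → δ i i x ≈ x
  δ-≡ i x = when-yes (i ≟ i) x ≡.refl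

  δ-≢ : ∀ {n} (i j : Fin n) x → i ≢ j → δ i j x ≈ 0#
  δ-≢ i j x = when-no (i ≟ j) x

  offDiagonal : ∀ {n} → Fin n → Fin n → Carrier → Carrier
  offDiagonal i j = when (¬? (i ≟ j))

  offDiagonal-≡ : ∀ {n} (i : Fin n) x → offDiagonal i i x ≈ 0#
  offDiagonal-≡ i x = when-no (¬? (i ≟ i)) x (λ i≢i → i≢i ≡.refl)

  offDiagonal-≢ : ∀ {n} {i j : Fin n} x → i ≢ j → offDiagonal i j x ≈ x
  offDiagonal-≢ {i = i} {j} x = when-yes (¬? (i ≟ j)) x

  -- A total version of punchOut; its value at i ≡ j is never used.
  punchOut′ : ∀ {n} → Fin (suc (suc n)) → Fin (suc (suc n)) → Fin (suc n)
  punchOut′         zero    zero    = zero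
  punchOut′         zero    (suc j) = j
  punchOut′         (suc i) zero    = zero
  punchOut′ {zero}  (suc i) (suc j) = zero
  punchOut′ {suc n} (suc i) (suc j) = suc (punchOut′ i j)

  punchOut′-punchIn : ∀ {n} (i : Fin (suc (suc n))) j → punchOut′ i (punchIn i j) ≡ j
  punchOut′-punchIn         zero    j       = ≡.refl
  punchOut′-punchIn         (suc i) zero    = ≡.refl
  punchOut′-punchIn {suc n} (suc i) (suc j) = ≡.cong suc (punchOut′-punchIn i j)

  punchIn-punchOut′ : ∀ {n} {i j : Fin (suc (suc n))} → i ≢ j → punchIn i (punchOut′ i j) ≡ j
  punchIn-punchOut′         {i = zero}  {zero}  i≢j = ⊥-elim (i≢j ≡.refl)
  punchIn-punchOut′         {i = zero}  {suc j} i≢j = ≡.refl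
  punchIn-punchOut′         {i = suc i} {zero}  i≢j = ≡.refl
  punchIn-punchOut′ {zero}  {i = suc zero} {suc zero} i≢j = ⊥-elim (i≢j ≡.refl)
  punchIn-punchOut′ {suc n} {i = suc i} {suc j} i≢j = ≡.cong suc (punchIn-punchOut′ {i = i} {j} (i≢j ∘ ≡.cong suc))

  punchIn-punchIn-comm : ∀ {n} {i j : Fin (suc (suc n))} → i ≢ j → ∀ (k : Fin n) →
    punchIn i (punchIn (punchOut′ i j) k) ≡ punchIn j (punchIn (punchOut′ j i) k)
  punchIn-punchIn-comm         {i = zero}  {zero}  i≢j k = ⊥-elim (i≢j ≡.refl)
  punchIn-punchIn-comm         {i = zero}  {suc j} i≢j k = ≡.refl
  punchIn-punchIn-comm         {i = suc i} {zero}  i≢j k = ≡.refl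
  punchIn-punchIn-comm {zero}  {i = suc zero} {suc zero} i≢j k = ⊥-elim (i≢j ≡.refl)
  punchIn-punchIn-comm {suc n} {i = suc i} {suc j} i≢j zero    = ≡.refl
  punchIn-punchIn-comm {suc n} {i = suc i} {suc j} i≢j (suc k) =
    ≡.cong suc (punchIn-punchIn-comm {i = i} {j} (i≢j ∘ ≡.cong suc) k)

  sign-punchOut′ : ∀ {n} {i j : Fin (suc (suc n))} → i ≢ j →
    sign (toℕ i) * sign (toℕ (punchOut′ i j)) ≈ - (sign (toℕ j) * sign (toℕ (punchOut′ j i)))
  sign-punchOut′ {i = zero} {zero} i≢j = ⊥-elim (i≢j ≡.refl)
  sign-punchOut′ {i = zero} {suc j} i≢j = begin
    1# * sign (toℕ j)            ≈⟨ *-identityˡ _ ⟩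
    sign (toℕ j)                 ≈⟨ -‿involutive _ ⟨
    - - sign (toℕ j)             ≈⟨ -‿cong (sign-suc (toℕ j)) ⟨
    - sign (suc (toℕ j))         ≈⟨ -‿cong (*-identityʳ _) ⟨
    - (sign (suc (toℕ j)) * 1#)  ∎
  sign-punchOut′ {i = suc i} {zero} i≢j = begin
    sign (suc (toℕ i)) * 1#  ≈⟨ *-identityʳ _ ⟩
    sign (suc (toℕ i))       ≈⟨ sign-suc (toℕ i) ⟩
    - sign (toℕ i)           ≈⟨ -‿cong (*-identityˡ _) ⟨
    - (1# * sign (toℕ i))    ∎
  sign-punchOut′ {zero} {i = suc zero} {suc zero} i≢j = ⊥-elim (i≢j ≡.refl)
  sign-punchOut′ {suc n} {i = suc i} {suc j} i≢j = begin
    sign (suc (toℕ i)) * sign (suc (toℕ (punchOut′ i j)))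
      ≈⟨ *-cong (sign-suc (toℕ i)) (sign-suc (toℕ (punchOut′ i j))) ⟩
    - sign (toℕ i) * - sign (toℕ (punchOut′ i j))
      ≈⟨ -‿*-‿ _ _ ⟩
    sign (toℕ i) * sign (toℕ (punchOut′ i j))
      ≈⟨ sign-punchOut′ {i = i} {j} (i≢j ∘ ≡.cong suc) ⟩
    - (sign (toℕ j) * sign (toℕ (punchOut′ j i)))
      ≈⟨ -‿cong (-‿*-‿ _ _) ⟨
    - (- sign (toℕ j) * - sign (toℕ (punchOut′ j i)))
      ≈⟨ -‿cong (*-cong (sign-suc (toℕ j)) (sign-suc (toℕ (punchOut′ j i)))) ⟨
    - (sign (suc (toℕ j)) * sign (suc (toℕ (punchOut′ j i)))) ∎

  ∑-punchIn : ∀ {n} (i : Fin (suc n)) (f : Fin (suc n) → Carrier) →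
    sum (λ k → f (punchIn i k)) ≈ sum (λ j → offDiagonal j i (f j))
  ∑-punchIn i f = sym (begin
    sum (λ j → offDiagonal j i (f j))
      ≈⟨ sum-remove {i = i} (λ j → offDiagonal j i (f j)) ⟩
    offDiagonal i i (f i) + sum (λ k → offDiagonal (punchIn i k) i (f (punchIn i k)))
      ≈⟨ +-cong (offDiagonal-≡ i (f i)) (sum-cong-≋ λ k → offDiagonal-≢ _ (punchInᵢ≢i i k)) ⟩
    0# + sum (λ k → f (punchIn i k))
      ≈⟨ +-identityˡ _ ⟩
    sum (λ k → f (punchIn i k)) ∎)

  module _ {n : ℕ} (L : Fin n → Fin (suc (suc n)) → Carrier) where

    minor₂ : Fin (suc (suc n)) → Fin (suc n) → Carrier
    minor₂ i k = det n λ r c → L r (punchIn i (punchIn k c))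

    twoRowTerm : (x y : Fin (suc (suc n)) → Carrier) → Fin (suc (suc n)) → Fin (suc n) → Carrier
    twoRowTerm x y i k = sign (toℕ i) * x i * (sign (toℕ k) * y (punchIn i k) * minor₂ i k)

    -- twoRowTerm indexed by the column j used in the second row instead of its position among the remaining columns.
    pairTerm : (x y : Fin (suc (suc n)) → Carrier) → Fin (suc (suc n)) → Fin (suc (suc n)) → Carrier
    pairTerm x y i j = offDiagonal j i (twoRowTerm x y i (punchOut′ i j))

    ∑-twoRowTerm : ∀ x y i → sum (twoRowTerm x y i) ≈ sum (pairTerm x y i)
    ∑-twoRowTerm x y i = trans
      (sum-cong-≋ λ k → reflexive (≡.cong (twoRowTerm x y i) (≡.sym (punchOut′-punchIn i k))))
      (∑-punchIn i λ j → twoRowTerm x y i (punchOut′ i j))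

    pairTerm-antisym : ∀ x y i j → pairTerm y x i j ≈ - pairTerm x y j i
    pairTerm-antisym x y i j = byCases (j ≟ i)
      where
      byCases : Dec (j ≡ i) → pairTerm y x i j ≈ - pairTerm x y j i
      byCases (yes ≡.refl) = trans (offDiagonal-≡ i _) (trans (sym -0#≈0#) (-‿cong (sym (offDiagonal-≡ i _))))
      byCases (no j≢i) = begin
        offDiagonal j i (twoRowTerm y x i j′)
          ≈⟨ offDiagonal-≢ _ j≢i ⟩
        sign (toℕ i) * y i * (sign (toℕ j′) * x (punchIn i j′) * minor₂ i j′)
          ≈⟨ *-cong refl (*-cong (*-cong refl (reflexive (≡.cong x (punchIn-punchOut′ i≢j))))
                                 (det-cong n λ r c → reflexive (≡.cong (L r) (punchIn-punchIn-comm i≢j c)))) ⟩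
        sign (toℕ i) * y i * (sign (toℕ j′) * x j * minor₂ j i′)
          ≈⟨ regroup (sign (toℕ i)) (y i) (sign (toℕ j′)) (x j) (minor₂ j i′) ⟩
        (sign (toℕ i) * sign (toℕ j′)) * (x j * y i * minor₂ j i′)
          ≈⟨ *-cong (sign-punchOut′ i≢j) refl ⟩
        - (sign (toℕ j) * sign (toℕ i′)) * (x j * y i * minor₂ j i′)
          ≈⟨ -‿distribˡ-* _ _ ⟨
        - ((sign (toℕ j) * sign (toℕ i′)) * (x j * y i * minor₂ j i′))
          ≈⟨ -‿cong (regroup′ (sign (toℕ j)) (x j) (sign (toℕ i′)) (y i) (minor₂ j i′)) ⟨
        - (sign (toℕ j) * x j * (sign (toℕ i′) * y i * minor₂ j i′))
          ≈⟨ -‿cong (*-cong refl (*-cong (*-cong refl (reflexive (≡.cong y (≡.sym (punchIn-punchOut′ j≢i))))) refl)) ⟩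
        - twoRowTerm x y j i′
          ≈⟨ -‿cong (offDiagonal-≢ _ i≢j) ⟨
        - offDiagonal i j (twoRowTerm x y j i′) ∎
        where
        i≢j = j≢i ∘ ≡.sym
        j′ = punchOut′ i j
        i′ = punchOut′ j i
        open RingSolver
        regroup : ∀ s a t b m → s * a * (t * b * m) ≈ (s * t) * (b * a * m)
        regroup = solve 5 (λ s a t b m → s :* a :* (t :* b :* m) := (s :* t) :* (b :* a :* m)) refl
        regroup′ : ∀ s a t b m → s * a * (t * b * m) ≈ (s * t) * (a * b * m)
        regroup′ = solve 5 (λ s a t b m → s :* a :* (t :* b :* m) := (s :* t) :* (a :* b :* m)) refl

  det-twoRows : ∀ n (M : Matrix (suc (suc n))) →
    det (suc (suc n)) M ≈ sum λ i → sum λ j → pairTerm (λ r → M (suc (suc r))) (M zero) (M (suc zero)) i j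
  det-twoRows n M = sum-cong-≋ λ i → trans
    (*-distribˡ-sum (sign (toℕ i) * M zero i) λ k → sign (toℕ k) * M (suc zero) (punchIn i k) * minor₂ (λ r → M (suc (suc r))) i k)
    (∑-twoRowTerm (λ r → M (suc (suc r))) (M zero) (M (suc zero)) i)

  -- adjSwap a exchanges inject₁ a and suc a.
  adjSwap : ∀ {n} → Fin n → Fin (suc n) → Fin (suc n)
  adjSwap zero    zero          = suc zero
  adjSwap zero    (suc zero)    = zero
  adjSwap zero    (suc (suc k)) = suc (suc k)
  adjSwap (suc a) zero          = zero
  adjSwap (suc a) (suc k)       = suc (adjSwap a k)

  ∑-sumRows-antisym : ∀ {n} {F G : Fin n → Fin n → Carrier} → (∀ i j → F i j ≈ - G j i) →
    sum (λ i → sum (F i)) ≈ - sum (λ i → sum (G i))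
  ∑-sumRows-antisym {F = F} {G} F≈-G = begin
    sum (λ i → sum (F i))            ≈⟨ sum-cong-≋ (λ i → trans (sum-cong-≋ (F≈-G i)) (∑-neg (λ j → G j i))) ⟩
    sum (λ i → - sum (λ j → G j i))  ≈⟨ ∑-neg (λ i → sum (λ j → G j i)) ⟩
    - sum (λ i → sum (λ j → G j i))  ≈⟨ -‿cong (∑-comm (λ i j → G j i)) ⟩
    - sum (λ j → sum (G j))          ∎

  det-swapRows₀ : ∀ n (M : Matrix (suc (suc n))) → det (suc (suc n)) (M ∘ adjSwap zero) ≈ - det (suc (suc n)) M
  det-swapRows₀ n M = begin
    det (suc (suc n)) (M ∘ adjSwap zero)
      ≈⟨ det-twoRows n (M ∘ adjSwap zero) ⟩
    sum (λ i → sum (pairTerm L (M (suc zero)) (M zero) i))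
      ≈⟨ ∑-sumRows-antisym (pairTerm-antisym L (M zero) (M (suc zero))) ⟩
    - sum (λ i → sum (pairTerm L (M zero) (M (suc zero)) i))
      ≈⟨ -‿cong (det-twoRows n M) ⟨
    - det (suc (suc n)) M ∎
    where
    L = λ r → M (suc (suc r))

  det-swapRows : ∀ n (a : Fin (suc n)) (M : Matrix (suc (suc n))) →
    det (suc (suc n)) (M ∘ adjSwap a) ≈ - det (suc (suc n)) M
  det-swapRows n       zero    M = det-swapRows₀ n M
  det-swapRows (suc n) (suc a) M = begin
    sum (λ j → sign (toℕ j) * M zero j * det (suc (suc n)) (minor M j ∘ adjSwap a))
      ≈⟨ sum-cong-≋ (λ j → *-cong (refl {sign (toℕ j) * M zero j}) (det-swapRows n a (minor M j))) ⟩
    sum (λ j → sign (toℕ j) * M zero j * - det (suc (suc n)) (minor M j))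
      ≈⟨ sum-cong-≋ (λ j → sym (-‿distribʳ-* (sign (toℕ j) * M zero j) (det (suc (suc n)) (minor M j)))) ⟩
    sum (λ j → - laplaceTerm M j)
      ≈⟨ ∑-neg (laplaceTerm M) ⟩
    - det (suc (suc (suc n))) M ∎

  -- In the expansion along row 0, column j is one of the two swapped columns, or it is fixed
  -- and the swap acts on the remaining columns as another adjacent swap.
  data AdjSwapView {m} (a : Fin (suc m)) : Fin (suc (suc m)) → Set where
    left  : AdjSwapView a (inject₁ a)
    right : AdjSwapView a (suc a)
    other : ∀ {j} (b : Fin m) → adjSwap a j ≡ j →
            (∀ k → adjSwap a (punchIn j k) ≡ punchIn j (adjSwap b k)) → AdjSwapView a j

  adjSwapView : ∀ {m} (a : Fin (suc m)) j → AdjSwapView a j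
  adjSwapView         zero    zero          = left
  adjSwapView         zero    (suc zero)    = right
  adjSwapView {suc m} zero    (suc (suc j)) = other zero ≡.refl λ
    { zero → ≡.refl ; (suc zero) → ≡.refl ; (suc (suc k)) → ≡.refl }
  adjSwapView {suc m} (suc a) zero          = other a ≡.refl λ _ → ≡.refl
  adjSwapView {suc m} (suc a) (suc j) with adjSwapView a j
  ... | left              = left
  ... | right             = right
  ... | other b fixes commutes = other (suc b) (≡.cong suc fixes) λ
    { zero → ≡.refl ; (suc k) → ≡.cong suc (commutes k) }

  adjSwap-inject₁ : ∀ {m} (a : Fin (suc m)) → adjSwap a (inject₁ a) ≡ suc a
  adjSwap-inject₁         zero    = ≡.refl
  adjSwap-inject₁ {suc m} (suc a) = ≡.cong suc (adjSwap-inject₁ a)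

  adjSwap-suc : ∀ {m} (a : Fin (suc m)) → adjSwap a (suc a) ≡ inject₁ a
  adjSwap-suc         zero    = ≡.refl
  adjSwap-suc {suc m} (suc a) = ≡.cong suc (adjSwap-suc a)

  adjSwap-punchIn-inject₁ : ∀ {m} (a : Fin (suc m)) k → adjSwap a (punchIn (inject₁ a) k) ≡ punchIn (suc a) k
  adjSwap-punchIn-inject₁         zero    zero    = ≡.refl
  adjSwap-punchIn-inject₁         zero    (suc k) = ≡.refl
  adjSwap-punchIn-inject₁ {suc m} (suc a) zero    = ≡.refl
  adjSwap-punchIn-inject₁ {suc m} (suc a) (suc k) = ≡.cong suc (adjSwap-punchIn-inject₁ a k)

  adjSwap-punchIn-suc : ∀ {m} (a : Fin (suc m)) k → adjSwap a (punchIn (suc a) k) ≡ punchIn (inject₁ a) k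
  adjSwap-punchIn-suc         zero    zero    = ≡.refl
  adjSwap-punchIn-suc         zero    (suc k) = ≡.refl
  adjSwap-punchIn-suc {suc m} (suc a) zero    = ≡.refl
  adjSwap-punchIn-suc {suc m} (suc a) (suc k) = ≡.cong suc (adjSwap-punchIn-suc a k)

  ∑-adjSwap : ∀ {n} (a : Fin n) (f : Fin (suc n) → Carrier) → sum (f ∘ adjSwap a) ≈ sum f
  ∑-adjSwap zero f = begin
    f (suc zero) + (f zero + sum (λ j → f (suc (suc j))))  ≈⟨ +-assoc _ _ _ ⟨
    (f (suc zero) + f zero) + sum (λ j → f (suc (suc j)))  ≈⟨ +-cong (+-comm _ _) refl ⟩
    (f zero + f (suc zero)) + sum (λ j → f (suc (suc j)))  ≈⟨ +-assoc _ _ _ ⟩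
    f zero + (f (suc zero) + sum (λ j → f (suc (suc j))))  ∎
  ∑-adjSwap (suc a) f = +-cong refl (∑-adjSwap a (f ∘ suc))

  sign-inject₁ : ∀ {m} (a : Fin m) → sign (toℕ (inject₁ a)) ≈ - sign (toℕ (suc a))
  sign-inject₁ a = trans (reflexive (≡.cong sign (toℕ-inject₁ a)))
    (trans (sym (-‿involutive _)) (-‿cong (sym (sign-suc (toℕ a)))))

  det-swapCols : ∀ m (a : Fin (suc m)) (M : Matrix (suc (suc m))) →
    det (suc (suc m)) (λ i j → M i (adjSwap a j)) ≈ - det (suc (suc m)) M
  laplaceTerm-swapCols : ∀ {m} (a : Fin (suc m)) (M : Matrix (suc (suc m))) j →
    laplaceTerm (λ i j → M i (adjSwap a j)) j ≈ - laplaceTerm M (adjSwap a j)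

  det-swapCols m a M = begin
    sum (laplaceTerm (λ i j → M i (adjSwap a j)))  ≈⟨ sum-cong-≋ (laplaceTerm-swapCols a M) ⟩
    sum (λ j → - laplaceTerm M (adjSwap a j))      ≈⟨ ∑-neg (laplaceTerm M ∘ adjSwap a) ⟩
    - sum (laplaceTerm M ∘ adjSwap a)              ≈⟨ -‿cong (∑-adjSwap a (laplaceTerm M)) ⟩
    - sum (laplaceTerm M)                          ∎

  laplaceTerm-swapCols {m} a M j with adjSwapView a j
  ... | left = begin
    sign (toℕ (inject₁ a)) * M zero (adjSwap a (inject₁ a)) * det (suc m) (λ r c → M (suc r) (adjSwap a (punchIn (inject₁ a) c)))
      ≈⟨ *-cong (*-cong (sign-inject₁ a) (reflexive (≡.cong (M zero) (adjSwap-inject₁ a))))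
                (det-cong (suc m) λ r c → reflexive (≡.cong (M (suc r)) (adjSwap-punchIn-inject₁ a c))) ⟩
    - sign (toℕ (suc a)) * M zero (suc a) * det (suc m) (minor M (suc a))
      ≈⟨ trans (*-cong (sym (-‿distribˡ-* _ _)) refl) (sym (-‿distribˡ-* _ _)) ⟩
    - laplaceTerm M (suc a)
      ≈⟨ -‿cong (reflexive (≡.cong (laplaceTerm M) (≡.sym (adjSwap-inject₁ a)))) ⟩
    - laplaceTerm M (adjSwap a (inject₁ a)) ∎
  ... | right = begin
    sign (toℕ (suc a)) * M zero (adjSwap a (suc a)) * det (suc m) (λ r c → M (suc r) (adjSwap a (punchIn (suc a) c)))
      ≈⟨ *-cong (*-cong (trans (sign-suc (toℕ a)) (-‿cong (reflexive (≡.cong sign (≡.sym (toℕ-inject₁ a))))))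
                        (reflexive (≡.cong (M zero) (adjSwap-suc a))))
                (det-cong (suc m) λ r c → reflexive (≡.cong (M (suc r)) (adjSwap-punchIn-suc a c))) ⟩
    - sign (toℕ (inject₁ a)) * M zero (inject₁ a) * det (suc m) (minor M (inject₁ a))
      ≈⟨ trans (*-cong (sym (-‿distribˡ-* _ _)) refl) (sym (-‿distribˡ-* _ _)) ⟩
    - laplaceTerm M (inject₁ a)
      ≈⟨ -‿cong (reflexive (≡.cong (laplaceTerm M) (≡.sym (adjSwap-suc a)))) ⟩
    - laplaceTerm M (adjSwap a (suc a)) ∎
  laplaceTerm-swapCols {suc m} a M j | other b fixes commutes = begin
    sign (toℕ j) * M zero (adjSwap a j) * det (suc (suc m)) (λ r c → M (suc r) (adjSwap a (punchIn j c)))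
      ≈⟨ *-cong (*-cong refl (reflexive (≡.cong (M zero) fixes)))
                (det-cong (suc (suc m)) λ r c → reflexive (≡.cong (M (suc r)) (commutes c))) ⟩
    sign (toℕ j) * M zero j * det (suc (suc m)) (λ r c → minor M j r (adjSwap b c))
      ≈⟨ *-cong refl (det-swapCols m b (minor M j)) ⟩
    sign (toℕ j) * M zero j * - det (suc (suc m)) (minor M j)
      ≈⟨ -‿distribʳ-* _ _ ⟨
    - laplaceTerm M j
      ≈⟨ -‿cong (reflexive (≡.cong (laplaceTerm M) (≡.sym fixes))) ⟩
    - laplaceTerm M (adjSwap a j) ∎

  DetInvariant : ∀ {n} → (Fin n → Fin n) → Set (c ⊔ ℓ)
  DetInvariant {n} f = ∀ M → det n (λ i j → M (f i) (f j)) ≈ det n M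

  adjSwap-detInvariant : ∀ {m} (a : Fin (suc m)) → DetInvariant (adjSwap a)
  adjSwap-detInvariant {m} a M = begin
    det (suc (suc m)) (λ i j → M (adjSwap a i) (adjSwap a j))  ≈⟨ det-swapRows m a (λ i j → M i (adjSwap a j)) ⟩
    - det (suc (suc m)) (λ i j → M i (adjSwap a j))            ≈⟨ -‿cong (det-swapCols m a M) ⟩
    - - det (suc (suc m)) M                                    ≈⟨ -‿involutive _ ⟩
    det (suc (suc m)) M                                        ∎

  detInvariant-∘ : ∀ {n} {f g : Fin n → Fin n} → DetInvariant f → DetInvariant g → DetInvariant (g ∘ f)
  detInvariant-∘ {f = f} {g} inv-f inv-g M = trans (inv-f λ i j → M (g i) (g j)) (inv-g M)

  detInvariant-ext : ∀ {n} {f g : Fin n → Fin n} → (∀ k → f k ≡ g k) → DetInvariant f → DetInvariant g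
  detInvariant-ext {n} f≗g inv-f M =
    trans (det-cong n λ i j → reflexive (≡.cong₂ M (≡.sym (f≗g i)) (≡.sym (f≗g j)))) (inv-f M)

  adjSwaps : ∀ {n} → List (Fin n) → Fin (suc n) → Fin (suc n)
  adjSwaps []       = id
  adjSwaps (a ∷ as) = adjSwap a ∘ adjSwaps as

  adjSwaps-detInvariant : ∀ {n} (as : List (Fin n)) → DetInvariant (adjSwaps as)
  adjSwaps-detInvariant         []       M = refl
  adjSwaps-detInvariant {suc n} (a ∷ as) =
    detInvariant-∘ {f = adjSwaps as} {adjSwap a} (adjSwaps-detInvariant as) (adjSwap-detInvariant a)

  adjSwaps-++ : ∀ {n} (as bs : List (Fin n)) k → adjSwaps (as ++ bs) k ≡ adjSwaps as (adjSwaps bs k)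
  adjSwaps-++ []       bs k = ≡.refl
  adjSwaps-++ (a ∷ as) bs k = ≡.cong (adjSwap a) (adjSwaps-++ as bs k)

  liftFin : ∀ {n} → (Fin n → Fin n) → Fin (suc n) → Fin (suc n)
  liftFin f zero    = zero
  liftFin f (suc k) = suc (f k)

  adjSwaps-map-suc : ∀ {n} (as : List (Fin n)) k → adjSwaps (map suc as) k ≡ liftFin (adjSwaps as) k
  adjSwaps-map-suc []       zero    = ≡.refl
  adjSwaps-map-suc []       (suc k) = ≡.refl
  adjSwaps-map-suc (a ∷ as) k with adjSwaps (map suc as) k | adjSwaps-map-suc as k
  ... | _ | ≡.refl with k
  ...   | zero  = ≡.refl
  ...   | suc _ = ≡.refl

  Swaps : ∀ {n} → Fin n → Fin n → (Fin n → Fin n) → Set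
  Swaps i j f = f i ≡ j × f j ≡ i × (∀ k → k ≢ i → k ≢ j → f k ≡ k)

  Swaps-sym : ∀ {n} {i j : Fin n} {f} → Swaps i j f → Swaps j i f
  Swaps-sym (fi , fj , fk) = fj , fi , λ k k≢j k≢i → fk k k≢i k≢j

  Swaps-lift : ∀ {n} {i j : Fin n} {f} → Swaps i j f → Swaps (suc i) (suc j) (liftFin f)
  Swaps-lift {f = f} (fi , fj , fk) = ≡.cong suc fi , ≡.cong suc fj , lifted
    where
    lifted : ∀ k → k ≢ suc _ → k ≢ suc _ → liftFin f k ≡ k
    lifted zero    _    _    = ≡.refl
    lifted (suc k) k≢i k≢j = ≡.cong suc (fk k (k≢i ∘ ≡.cong suc) (k≢j ∘ ≡.cong suc))

  Swaps-ext : ∀ {n} {i j : Fin n} {f g} → (∀ k → f k ≡ g k) → Swaps i j f → Swaps i j g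
  Swaps-ext {i = i} {j} f≗g (fi , fj , fk) =
    ≡.trans (≡.sym (f≗g i)) fi , ≡.trans (≡.sym (f≗g j)) fj ,
    λ k k≢i k≢j → ≡.trans (≡.sym (f≗g k)) (fk k k≢i k≢j)

  -- transpose 0 (j + 2) is transpose 1 (j + 2) conjugated by adjSwap 0.
  swapsFromZero : ∀ {n} → Fin n → List (Fin n)
  swapsFromZero {suc n}       zero    = zero ∷ []
  swapsFromZero {suc (suc n)} (suc j) = zero ∷ (map suc (swapsFromZero j) ++ zero ∷ [])

  swapsFromZero-swaps : ∀ {n} (j : Fin n) → Swaps zero (suc j) (adjSwaps (swapsFromZero j))
  swapsFromZero-swaps {suc n} zero = ≡.refl , ≡.refl , fixes
    where
    fixes : ∀ k → k ≢ zero → k ≢ suc zero → adjSwap zero k ≡ k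
    fixes zero          k≢0 _   = ⊥-elim (k≢0 ≡.refl)
    fixes (suc zero)    _   k≢1 = ⊥-elim (k≢1 ≡.refl)
    fixes (suc (suc k)) _   _   = ≡.refl
  swapsFromZero-swaps {suc (suc n)} (suc j) = ≡.trans (unfold zero) (≡.cong (adjSwap zero ∘ suc) fi)
                                            , ≡.trans (unfold (suc (suc j))) (≡.cong (adjSwap zero ∘ suc) fj)
                                            , fixes
    where
    f = adjSwaps (swapsFromZero j)
    fi = proj₁ (swapsFromZero-swaps j)
    fj = proj₁ (proj₂ (swapsFromZero-swaps j))
    fk = proj₂ (proj₂ (swapsFromZero-swaps j))
    unfold : ∀ k → adjSwaps (swapsFromZero (suc j)) k ≡ adjSwap zero (liftFin f (adjSwap zero k))
    unfold k = ≡.cong (adjSwap zero)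
      (≡.trans (adjSwaps-++ (map suc (swapsFromZero j)) (zero ∷ []) k) (adjSwaps-map-suc (swapsFromZero j) (adjSwap zero k)))
    fixes : ∀ k → k ≢ zero → k ≢ suc (suc j) → adjSwaps (swapsFromZero (suc j)) k ≡ k
    fixes zero          k≢0 _   = ⊥-elim (k≢0 ≡.refl)
    fixes (suc zero)    _   _   = unfold (suc zero)
    fixes (suc (suc k)) _   k≢j = ≡.trans (unfold (suc (suc k)))
      (≡.cong (adjSwap zero ∘ suc) (fk (suc k) (λ ()) (k≢j ∘ ≡.cong suc)))

  swapsBetween : ∀ {n} → Fin (suc n) → Fin (suc n) → List (Fin n)
  swapsBetween         zero    zero    = []
  swapsBetween         zero    (suc j) = swapsFromZero j
  swapsBetween         (suc i) zero    = swapsFromZero i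
  swapsBetween {suc n} (suc i) (suc j) = map suc (swapsBetween i j)

  swapsBetween-swaps : ∀ {n} (i j : Fin (suc n)) → Swaps i j (adjSwaps (swapsBetween i j))
  swapsBetween-swaps         zero    zero    = ≡.refl , ≡.refl , λ _ _ _ → ≡.refl
  swapsBetween-swaps {suc n} zero    (suc j) = swapsFromZero-swaps j
  swapsBetween-swaps {suc n} (suc i) zero    = Swaps-sym (swapsFromZero-swaps i)
  swapsBetween-swaps {suc n} (suc i) (suc j) =
    Swaps-ext (λ k → ≡.sym (adjSwaps-map-suc (swapsBetween i j) k)) (Swaps-lift (swapsBetween-swaps i j))

  Swaps⇒transpose : ∀ {n} {i j : Fin n} {f} → Swaps i j f → ∀ k → f k ≡ transpose i j k
  Swaps⇒transpose {i = i} {j} (fi , fj , fk) k with k ≟ i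
  ... | yes ≡.refl = fi
  ... | no k≢i with k ≟ j
  ...   | yes ≡.refl = fj
  ...   | no k≢j     = fk k k≢i k≢j

  transpose-detInvariant : ∀ {n} (i j : Fin n) → DetInvariant (transpose i j)
  transpose-detInvariant {suc n} i j =
    detInvariant-ext (Swaps⇒transpose (swapsBetween-swaps i j)) (adjSwaps-detInvariant (swapsBetween i j))

  permutation-detInvariant : ∀ {n} (π : Permutation′ n) → DetInvariant (π ⟨$⟩ʳ_)
  permutation-detInvariant π = detInvariant-ext (eval-decompose π) (eval-detInvariant (decompose π))
    where
    eval-detInvariant : ∀ {n} (xs : TranspositionList n) → DetInvariant (eval xs ⟨$⟩ʳ_)
    eval-detInvariant []             M = refl
    eval-detInvariant ((i , j) ∷ xs) =
      detInvariant-∘ {f = transpose i j} {eval xs ⟨$⟩ʳ_} (transpose-detInvariant i j) (eval-detInvariant xs)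

  det₁ : ∀ (M : Matrix 1) → det 1 M ≈ M zero zero
  det₁ M = trans (+-identityʳ _) (trans (*-identityʳ _) (*-identityˡ _))

  det-addCol₀ : ∀ n (A B C : Matrix (suc n)) → (∀ i → C i zero ≈ A i zero + B i zero) →
    (∀ i k → A i (suc k) ≈ C i (suc k)) → (∀ i k → B i (suc k) ≈ C i (suc k)) →
    det (suc n) A + det (suc n) B ≈ det (suc n) C
  det-addCol₀ zero    A B C C≈A+B A≈C B≈C =
    trans (+-cong (det₁ A) (det₁ B)) (trans (sym (C≈A+B zero)) (sym (det₁ C)))
  det-addCol₀ (suc n) A B C C≈A+B A≈C B≈C = begin
    sum (laplaceTerm A) + sum (laplaceTerm B)      ≈⟨ ∑-distrib-+ (laplaceTerm A) (laplaceTerm B) ⟨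
    sum (λ j → laplaceTerm A j + laplaceTerm B j)  ≈⟨ sum-cong-≋ termwise ⟩
    sum (laplaceTerm C)                            ∎
    where
    termwise : ∀ j → laplaceTerm A j + laplaceTerm B j ≈ laplaceTerm C j
    termwise zero = begin
      1# * A zero zero * det (suc n) (minor A zero) + 1# * B zero zero * det (suc n) (minor B zero)
        ≈⟨ +-cong (*-cong refl (det-cong (suc n) λ r k → A≈C (suc r) k))
                  (*-cong refl (det-cong (suc n) λ r k → B≈C (suc r) k)) ⟩
      1# * A zero zero * det (suc n) (minor C zero) + 1# * B zero zero * det (suc n) (minor C zero)
        ≈⟨ distribʳ _ _ _ ⟨
      (1# * A zero zero + 1# * B zero zero) * det (suc n) (minor C zero)
        ≈⟨ *-cong (trans (sym (distribˡ 1# _ _)) (*-cong refl (sym (C≈A+B zero)))) refl ⟩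
      1# * C zero zero * det (suc n) (minor C zero) ∎
    termwise (suc j) = begin
      s * A zero (suc j) * det (suc n) (minor A (suc j)) + s * B zero (suc j) * det (suc n) (minor B (suc j))
        ≈⟨ +-cong (*-cong (*-cong refl (A≈C zero j)) refl) (*-cong (*-cong refl (B≈C zero j)) refl) ⟩
      s * C zero (suc j) * det (suc n) (minor A (suc j)) + s * C zero (suc j) * det (suc n) (minor B (suc j))
        ≈⟨ distribˡ _ _ _ ⟨
      s * C zero (suc j) * (det (suc n) (minor A (suc j)) + det (suc n) (minor B (suc j)))
        ≈⟨ *-cong refl (det-addCol₀ n (minor A (suc j)) (minor B (suc j)) (minor C (suc j))
                         (C≈A+B ∘ suc) (λ i k → A≈C (suc i) (punchIn j k)) (λ i k → B≈C (suc i) (punchIn j k))) ⟩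
      s * C zero (suc j) * det (suc n) (minor C (suc j)) ∎
      where
      s = sign (toℕ (suc j))

  mergeCols₀₁ : ∀ {n} → Matrix (suc (suc n)) → Matrix (suc n)
  mergeCols₀₁ M r zero    = M (suc r) (suc zero) + M (suc r) zero
  mergeCols₀₁ M r (suc k) = M (suc r) (suc (suc k))

  module _ (2-torsion-free : ∀ x → x + x ≈ 0# → x ≈ 0#) where

    -- Swapping the two equal rows gives det M ≈ - det M, whence the need for 2-torsion-freeness.
    det-equalRows₀₁ : ∀ n (M : Matrix (suc (suc n))) → (∀ j → M zero j ≈ M (suc zero) j) → det (suc (suc n)) M ≈ 0#
    det-equalRows₀₁ n M row₀≈row₁ = 2-torsion-free _ (begin
      det (suc (suc n)) M + det (suc (suc n)) M                   ≈⟨ +-cong (det-cong (suc (suc n)) swapped≈M) refl ⟨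
      det (suc (suc n)) (M ∘ adjSwap zero) + det (suc (suc n)) M  ≈⟨ +-cong (det-swapRows₀ n M) refl ⟩
      - det (suc (suc n)) M + det (suc (suc n)) M                 ≈⟨ -‿inverseˡ _ ⟩
      0#                                                          ∎)
      where
      swapped≈M : ∀ i j → M (adjSwap zero i) j ≈ M i j
      swapped≈M zero          j = sym (row₀≈row₁ j)
      swapped≈M (suc zero)    j = row₀≈row₁ j
      swapped≈M (suc (suc i)) j = refl

    -- By linearity in row 0, the part with row 1 vanishes (equal rows)
    -- and the rest is x times the sum of the minors at (0, 0) and (0, 1), which differ only in column 0.
    det-twinRows : ∀ n (M : Matrix (suc (suc n))) x →
      (∀ j → M zero j ≈ M (suc zero) j + (δ zero j x - δ (suc zero) j x)) →
      det (suc (suc n)) M ≈ x * det (suc n) (mergeCols₀₁ M)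
    det-twinRows n M x row₀≈row₁+x[e₀-e₁] = begin
      det (suc (suc n)) M
        ≈⟨ +-cong (*-cong (*-cong refl e₀) refl)
                  (+-cong (*-cong (*-cong refl e₁) refl) (sum-cong-≋ λ j → *-cong (*-cong refl (e₊ j)) refl)) ⟩
      1# * (y₀ + x) * D₀ + (- 1# * (y₁ + - x) * D₁ + S)
        ≈⟨ split 1# (- 1#) y₀ y₁ x (- x) D₀ D₁ S ⟩
      (1# * y₀ * D₀ + (- 1# * y₁ * D₁ + S)) + (1# * x * D₀ + - 1# * - x * D₁)
        ≈⟨ +-cong refl (trans (+-cong refl (*-cong (-‿*-‿ 1# x) refl)) (sym (distribˡ (1# * x) D₀ D₁))) ⟩
      (1# * y₀ * D₀ + (- 1# * y₁ * D₁ + S)) + 1# * x * (D₀ + D₁)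
        ≈⟨ +-cong (det-equalRows₀₁ n M′ λ _ → refl)
                  (*-cong (*-identityˡ x) (det-addCol₀ n (minor M zero) (minor M (suc zero)) (mergeCols₀₁ M)
                                             (λ _ → refl) (λ _ _ → refl) (λ _ _ → refl))) ⟩
      0# + x * det (suc n) (mergeCols₀₁ M)
        ≈⟨ +-identityˡ _ ⟩
      x * det (suc n) (mergeCols₀₁ M) ∎
      where
      y₀ = M (suc zero) zero
      y₁ = M (suc zero) (suc zero)
      D₀ = det (suc n) (minor M zero)
      D₁ = det (suc n) (minor M (suc zero))
      S = sum λ j → sign (toℕ (suc (suc j))) * M (suc zero) (suc (suc j)) * det (suc n) (minor M (suc (suc j)))
      x-0≈x : ∀ x → x - 0# ≈ x
      x-0≈x x = trans (+-cong refl -0#≈0#) (+-identityʳ x)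
      y₊ = λ j → M (suc zero) (suc (suc j))
      e₀ : M zero zero ≈ M (suc zero) zero + x
      e₀ = trans (row₀≈row₁+x[e₀-e₁] zero) (+-cong (refl {y₀}) (x-0≈x x))
      e₁ : M zero (suc zero) ≈ M (suc zero) (suc zero) - x
      e₁ = trans (row₀≈row₁+x[e₀-e₁] (suc zero)) (+-cong (refl {y₁}) (+-identityˡ (- x)))
      e₊ : ∀ j → M zero (suc (suc j)) ≈ M (suc zero) (suc (suc j))
      e₊ j = trans (row₀≈row₁+x[e₀-e₁] (suc (suc j))) (trans (+-cong (refl {y₊ j}) (x-0≈x 0#)) (+-identityʳ (y₊ j)))
      M′ : Matrix (suc (suc n))
      M′ zero    = M (suc zero)
      M′ (suc i) = M (suc i)
      open RingSolver
      split : ∀ s s′ y₀ y₁ x x′ D₀ D₁ S →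
        s * (y₀ + x) * D₀ + (s′ * (y₁ + x′) * D₁ + S) ≈
        (s * y₀ * D₀ + (s′ * y₁ * D₁ + S)) + (s * x * D₀ + s′ * x′ * D₁)
      split = solve 9 (λ s s′ y₀ y₁ x x′ D₀ D₁ S →
        s :* (y₀ :+ x) :* D₀ :+ (s′ :* (y₁ :+ x′) :* D₁ :+ S) :=
        (s :* y₀ :* D₀ :+ (s′ :* y₁ :* D₁ :+ S)) :+ (s :* x :* D₀ :+ s′ :* x′ :* D₁)) refl


module EquitablePartition {c ℓ} (R : CommutativeRing c ℓ) where

  open import Data.Nat using (ℕ; zero; suc; _∸_)
  open import Data.Fin using (Fin; zero; suc; punchIn; _≟_)
  open import Data.Fin.Properties using (punchInᵢ≢i; suc-injective; any?; ¬Fin0)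
  open import Data.Product using (Σ; _×_; _,_; proj₁; proj₂)
  open import Data.Fin.Permutation using (Permutation′; _⟨$⟩ʳ_; _⟨$⟩ˡ_)
  import Data.Fin.Permutation as Perm
  open import Data.Fin.Permutation.Components using (transpose; transpose-inverse)
  open import Data.Sum using (_⊎_; inj₁; inj₂)
  open import Data.Empty using (⊥-elim)
  open import Function using (_∘_)
  open import Function.Definitions using (Injective; StrictlySurjective)
  open import Relation.Binary.PropositionalEquality as ≡ using (_≡_; _≢_)
  open import Relation.Nullary using (yes; no)

  open CommutativeRing R hiding (zero)
  open Determinant R
  open import Algebra.Properties.CommutativeMonoid.Sum +-commutativeMonoid
    using (sum; sum-cong-≋; sum-remove; sum-permute)
  open import Algebra.Properties.CommutativeMonoid.Sum *-commutativeMonoid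
    using () renaming (sum to ∏; sum-cong-≋ to ∏-cong; sum-remove to ∏-remove; sum-replicate-zero to ∏-replicate-1#)
  open import Algebra.Properties.Semiring.Exp semiring using (_^_)
  open Indicator using (𝟙; 𝟙-yes; 𝟙-no; ∑-𝟙≟)
  open import Relation.Binary.Reasoning.Setoid setoid

  δ-injective : ∀ {m n} (f : Fin m → Fin n) → Injective _≡_ _≡_ f → ∀ i j x → δ (f i) (f j) x ≈ δ i j x
  δ-injective f inj i j = when-cong inj (≡.cong f) (f i ≟ f j) (i ≟ j)

  δ-+ : ∀ {n} (i j : Fin n) x y → δ i j (x + y) ≈ δ i j x + δ i j y
  δ-+ i j x y with i ≟ j
  ... | yes _ = refl
  ... | no _  = sym (+-identityˡ 0#)

  ∑-δ : ∀ {n} (i : Fin n) (f : Fin n → Carrier) → sum (λ z → δ z i (f z)) ≈ f i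
  ∑-δ {suc n} i f = begin
    sum (λ z → δ z i (f z))                                 ≈⟨ sum-remove {i = i} (λ z → δ z i (f z)) ⟩
    δ i i (f i) + sum (λ k → δ (punchIn i k) i (f (punchIn i k)))
      ≈⟨ +-cong (δ-≡ i (f i)) (∑-zero _ λ k → δ-≢ (punchIn i k) i _ (punchInᵢ≢i i k)) ⟩
    f i + 0#                                                ≈⟨ +-identityʳ (f i) ⟩
    f i                                                     ∎

  injective-or-collision : ∀ {m n} (c : Fin m → Fin n) →
    Injective _≡_ _≡_ c ⊎ Σ (Fin m) λ u → Σ (Fin m) λ v → u ≢ v × c u ≡ c v
  injective-or-collision {zero}  c = inj₁ λ {u} → ⊥-elim (¬Fin0 u)
  injective-or-collision {suc m} c with any? (λ z → c (suc z) ≟ c zero)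
  ... | yes (z , c[1+z]≡c0) = inj₂ (suc z , zero , (λ ()) , c[1+z]≡c0)
  ... | no none with injective-or-collision (c ∘ suc)
  ...   | inj₂ (u , v , u≢v , cu≡cv) = inj₂ (suc u , suc v , u≢v ∘ suc-injective , cu≡cv)
  ...   | inj₁ c∘suc-injective = inj₁ λ {u} {v} → injective u v
    where
    injective : ∀ u v → c u ≡ c v → u ≡ v
    injective zero    zero    _ = ≡.refl
    injective zero    (suc v) e = ⊥-elim (none (v , ≡.sym e))
    injective (suc u) zero    e = ⊥-elim (none (u , e))
    injective (suc u) (suc v) e = ≡.cong suc (c∘suc-injective e)

  transpose-swaps : ∀ {n} (i j : Fin n) → Swaps i j (transpose i j)
  transpose-swaps i j = transpose-at-i , transpose-at-j , transpose-fixes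
    where
    transpose-at-i : transpose i j i ≡ j
    transpose-at-i with i ≟ i
    ... | yes _  = ≡.refl
    ... | no i≢i = ⊥-elim (i≢i ≡.refl)
    transpose-at-j : transpose i j j ≡ i
    transpose-at-j with j ≟ i
    ... | yes j≡i = j≡i
    ... | no _ with j ≟ j
    ...   | yes _  = ≡.refl
    ...   | no j≢j = ⊥-elim (j≢j ≡.refl)
    transpose-fixes : ∀ k → k ≢ i → k ≢ j → transpose i j k ≡ k
    transpose-fixes k k≢i k≢j with k ≟ i
    ... | yes k≡i = ⊥-elim (k≢i k≡i)
    ... | no _ with k ≟ j
    ...   | yes k≡j = ⊥-elim (k≢j k≡j)
    ...   | no _    = ≡.refl

  moveToFront : ∀ {n} {u v : Fin (suc (suc n))} → u ≢ v →
    Σ (Permutation′ (suc (suc n))) λ σ → σ ⟨$⟩ʳ zero ≡ u × σ ⟨$⟩ʳ suc zero ≡ v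
  moveToFront {u = u} {v} u≢v = σ , σ0≡u , σ1≡v
    where
    v′ = transpose u zero v
    v′≢0 : v′ ≢ zero
    v′≢0 v′≡0 = u≢v (≡.trans (≡.sym (proj₁ (transpose-swaps zero u)))
                     (≡.trans (≡.cong (transpose zero u) (≡.sym v′≡0)) (transpose-inverse zero u)))
    σ = Perm.transpose (suc zero) v′ Perm.∘ₚ Perm.transpose zero u
    σ0≡u : σ ⟨$⟩ʳ zero ≡ u
    σ0≡u = ≡.trans (≡.cong (transpose zero u) (proj₂ (proj₂ (transpose-swaps (suc zero) v′)) zero (λ ()) (v′≢0 ∘ ≡.sym)))
                   (proj₁ (transpose-swaps zero u))
    σ1≡v : σ ⟨$⟩ʳ suc zero ≡ v
    σ1≡v = ≡.trans (≡.cong (transpose zero u) (proj₁ (transpose-swaps (suc zero) v′))) (transpose-inverse zero u)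

  ∏-factor : ∀ {n} (k : Fin n) {f g : Fin n → Carrier} a →
    f k ≈ a * g k → (∀ l → l ≢ k → f l ≈ g l) → ∏ f ≈ a * ∏ g
  ∏-factor {suc n} k {f} {g} a fk≈a*gk fl≈gl = begin
    ∏ f                            ≈⟨ ∏-remove {i = k} f ⟩
    f k * ∏ (f ∘ punchIn k)        ≈⟨ *-cong fk≈a*gk (∏-cong λ l → fl≈gl (punchIn k l) (punchInᵢ≢i k l)) ⟩
    a * g k * ∏ (g ∘ punchIn k)    ≈⟨ *-assoc a (g k) _ ⟩
    a * (g k * ∏ (g ∘ punchIn k))  ≈⟨ *-cong refl (∏-remove {i = k} g) ⟨
    a * ∏ g                        ∎

  module Blowup (2-torsion-free : ∀ x → x + x ≈ 0# → x ≈ 0#) {K : ℕ} (d : Fin K → Carrier) (B : Matrix K) where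

    -- The column weights w are there because merging two twin columns adds their weights.
    blowup : ∀ {N} → (Fin N → Fin K) → (Fin N → Carrier) → Matrix N
    blowup c w i j = δ i j (d (c i)) - B (c i) (c j) * w j

    quotient : (Fin K → Carrier) → Matrix K
    quotient t k l = δ k l (d k) - B k l * t l

    classWeight : ∀ {N} → (Fin N → Fin K) → (Fin N → Carrier) → Fin K → Carrier
    classWeight c w k = sum λ z → δ (c z) k (w z)

    classSize : ∀ {N} → (Fin N → Fin K) → Fin K → ℕ
    classSize c k = Indicator.sum λ z → 𝟙 (c z ≟ k)

    -- Each class of size s contributes d k with multiplicity s - 1; for an empty class the
    -- truncated s ∸ 1 would give the wrong factor 1, which is why det-blowup assumes c surjective.
    multiplicityFactor : ∀ {N} → (Fin N → Fin K) → Carrier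
    multiplicityFactor c = ∏ λ k → d k ^ (classSize c k ∸ 1)

    Factorises : ∀ {N} → (Fin N → Fin K) → (Fin N → Carrier) → Set ℓ
    Factorises {N} c w = det N (blowup c w) ≈ multiplicityFactor c * det K (quotient (classWeight c w))

    det-quotient-cong : ∀ {t u : Fin K → Carrier} → (∀ k → t k ≈ u k) → det K (quotient t) ≈ det K (quotient u)
    det-quotient-cong t≈u = det-cong K λ k l → +-cong refl (-‿cong (*-cong refl (t≈u l)))

    multiplicityFactor-cong : ∀ {M N} (c : Fin M → Fin K) (c′ : Fin N → Fin K) →
      (∀ k → classSize c k ≡ classSize c′ k) → multiplicityFactor c ≈ multiplicityFactor c′
    multiplicityFactor-cong c c′ sizes = ∏-cong λ k → reflexive (≡.cong (λ s → d k ^ (s ∸ 1)) (sizes k))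

    classWeight-injective : ∀ {N} {c : Fin N → Fin K} w → Injective _≡_ _≡_ c → ∀ j → classWeight c w (c j) ≈ w j
    classWeight-injective {c = c} w inj j = trans (sum-cong-≋ λ z → δ-injective c inj z j (w z)) (∑-δ j w)

    classSize-bijective : ∀ {N} {c : Fin N → Fin K} → Injective _≡_ _≡_ c → StrictlySurjective _≡_ c →
      ∀ k → classSize c k ≡ 1
    classSize-bijective {c = c} inj surj k with surj k
    ... | z , ≡.refl =
      ≡.trans (Indicator.sum-cong-≗ λ y → Indicator.𝟙-cong inj (≡.cong c) (c y ≟ c z) (y ≟ z)) (∑-𝟙≟ z)

    det-blowup-bijective : ∀ {N} (c : Fin N → Fin K) w → N ≡ K → Injective _≡_ _≡_ c → StrictlySurjective _≡_ c →
      Factorises c w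
    det-blowup-bijective c w ≡.refl inj surj = begin
      det K (blowup c w)                         ≈⟨ det-cong K blowup≈quotient ⟩
      det K (λ i j → quotient t (c i) (c j))     ≈⟨ permutation-detInvariant π (quotient t) ⟩
      det K (quotient t)                         ≈⟨ *-identityˡ _ ⟨
      1# * det K (quotient t)                    ≈⟨ *-cong (sym factor≈1) refl ⟩
      multiplicityFactor c * det K (quotient t)  ∎
      where
      t = classWeight c w
      π : Permutation′ K
      π = Perm.permutation c (proj₁ ∘ surj) (proj₂ ∘ surj) (λ z → inj (proj₂ (surj (c z))))
      blowup≈quotient : ∀ i j → blowup c w i j ≈ quotient t (c i) (c j)
      blowup≈quotient i j = +-cong (sym (δ-injective c inj i j _)) (-‿cong (*-cong refl (sym (classWeight-injective w inj j))))
      factor≈1 : multiplicityFactor c ≈ 1#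
      factor≈1 = trans (∏-cong λ k → reflexive (≡.cong (λ s → d k ^ (s ∸ 1)) (classSize-bijective inj surj k)))
                       (∏-replicate-1# K)

    mergeFirstTwo : ∀ {N} → (Fin (suc (suc N)) → Carrier) → Fin (suc N) → Carrier
    mergeFirstTwo w zero    = w zero + w (suc zero)
    mergeFirstTwo w (suc r) = w (suc (suc r))

    module _ {N} (c : Fin (suc (suc N)) → Fin K) (w : Fin (suc (suc N)) → Carrier) (c0≡c1 : c zero ≡ c (suc zero)) where

      private
        k = c zero

      blowup-twinRows : ∀ j → blowup c w zero j ≈ blowup c w (suc zero) j + (δ zero j (d k) - δ (suc zero) j (d k))
      blowup-twinRows j rewrite ≡.sym c0≡c1 = sym (rearrange (δ zero j (d k)) (δ (suc zero) j (d k)) (B k (c j) * w j))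
        where
        open RingSolver
        rearrange : ∀ x₀ x₁ y → (x₁ - y) + (x₀ - x₁) ≈ x₀ - y
        rearrange x₀ x₁ y = begin
          (x₁ - y) + (x₀ - x₁)  ≈⟨ solve 3 (λ x₀ x₁ y → (x₁ :- y) :+ (x₀ :- x₁) := (x₀ :- y) :+ (x₁ :- x₁)) refl x₀ x₁ y ⟩
          (x₀ - y) + (x₁ - x₁)  ≈⟨ +-cong refl (-‿inverseʳ x₁) ⟩
          (x₀ - y) + 0#         ≈⟨ +-identityʳ _ ⟩
          x₀ - y                ∎

      mergeCols-blowup : ∀ r l → mergeCols₀₁ (blowup c w) r l ≈ blowup (c ∘ suc) (mergeFirstTwo w) r l
      mergeCols-blowup r zero rewrite ≡.sym c0≡c1 = begin
        (δ (suc r) (suc zero) x - b * w (suc zero)) + (0# - b * w zero)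
          ≈⟨ +-cong (+-cong (δ-injective suc suc-injective r zero x) refl) refl ⟩
        (δ r zero x - b * w (suc zero)) + (0# - b * w zero)
          ≈⟨ +-cong refl (+-identityˡ _) ⟩
        (δ r zero x - b * w (suc zero)) + - (b * w zero)
          ≈⟨ rearrange (δ r zero x) b (w zero) (w (suc zero)) ⟩
        δ r zero x - b * (w zero + w (suc zero)) ∎
        where
        x = d (c (suc r))
        b = B (c (suc r)) k
        open RingSolver
        rearrange : ∀ a b w₀ w₁ → (a - b * w₁) + - (b * w₀) ≈ a - b * (w₀ + w₁)
        rearrange = solve 4 (λ a b w₀ w₁ → (a :- b :* w₁) :+ :- (b :* w₀) := a :- b :* (w₀ :+ w₁)) refl
      mergeCols-blowup r (suc l) = +-cong (δ-injective suc suc-injective r (suc l) _) refl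

      classWeight-merge : ∀ l → classWeight c w l ≈ classWeight (c ∘ suc) (mergeFirstTwo w) l
      classWeight-merge l = begin
        δ k l (w zero) + (δ (c (suc zero)) l (w (suc zero)) + rest)
          ≈⟨ +-assoc _ _ _ ⟨
        (δ k l (w zero) + δ (c (suc zero)) l (w (suc zero))) + rest
          ≈⟨ +-cong (+-cong (reflexive (≡.cong (λ k′ → δ k′ l (w zero)) c0≡c1)) refl) refl ⟩
        (δ (c (suc zero)) l (w zero) + δ (c (suc zero)) l (w (suc zero))) + rest
          ≈⟨ +-cong (δ-+ (c (suc zero)) l _ _) refl ⟨
        δ (c (suc zero)) l (w zero + w (suc zero)) + rest ∎
        where
        rest = sum λ r → δ (c (suc (suc r))) l (w (suc (suc r)))

      multiplicityFactor-merge : multiplicityFactor c ≈ d k * multiplicityFactor (c ∘ suc)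
      multiplicityFactor-merge = ∏-factor k (d k) at-k elsewhere
        where
        at-k : d k ^ (classSize c k ∸ 1) ≈ d k * d k ^ (classSize (c ∘ suc) k ∸ 1)
        at-k rewrite 𝟙-yes (c zero ≟ k) ≡.refl | 𝟙-yes (c (suc zero) ≟ k) (≡.sym c0≡c1) = refl
        elsewhere : ∀ l → l ≢ k → d l ^ (classSize c l ∸ 1) ≈ d l ^ (classSize (c ∘ suc) l ∸ 1)
        elsewhere l l≢k rewrite 𝟙-no (c zero ≟ l) (l≢k ∘ ≡.sym) = refl

      tail-surjective : StrictlySurjective _≡_ c → StrictlySurjective _≡_ (c ∘ suc)
      tail-surjective surj l with surj l
      ... | zero  , c0≡l = zero , ≡.trans (≡.sym c0≡c1) c0≡l
      ... | suc r , cr≡l = r , cr≡l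

      det-blowup-twins : Factorises (c ∘ suc) (mergeFirstTwo w) → Factorises c w
      det-blowup-twins IH = begin
        det (suc (suc N)) (blowup c w)                    ≈⟨ det-twinRows 2-torsion-free N (blowup c w) (d k) blowup-twinRows ⟩
        d k * det (suc N) (mergeCols₀₁ (blowup c w))      ≈⟨ *-cong refl (det-cong (suc N) mergeCols-blowup) ⟩
        d k * det (suc N) (blowup (c ∘ suc) w′)           ≈⟨ *-cong refl IH ⟩
        d k * (multiplicityFactor (c ∘ suc) * det K (quotient (classWeight (c ∘ suc) w′)))
          ≈⟨ *-assoc _ _ _ ⟨
        d k * multiplicityFactor (c ∘ suc) * det K (quotient (classWeight (c ∘ suc) w′))
          ≈⟨ *-cong (sym multiplicityFactor-merge) (det-quotient-cong λ l → sym (classWeight-merge l)) ⟩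
        multiplicityFactor c * det K (quotient (classWeight c w)) ∎
        where
        w′ = mergeFirstTwo w

    module _ {N} (c : Fin N → Fin K) (w : Fin N → Carrier) (σ : Permutation′ N) where

      private
        σ-injective : Injective _≡_ _≡_ (σ ⟨$⟩ʳ_)
        σ-injective σi≡σj = ≡.trans (≡.sym (Perm.inverseˡ σ)) (≡.trans (≡.cong (σ ⟨$⟩ˡ_) σi≡σj) (Perm.inverseˡ σ))

      blowup-permute : ∀ i j → blowup (c ∘ (σ ⟨$⟩ʳ_)) (w ∘ (σ ⟨$⟩ʳ_)) i j ≈ blowup c w (σ ⟨$⟩ʳ i) (σ ⟨$⟩ʳ j)
      blowup-permute i j = +-cong (sym (δ-injective (σ ⟨$⟩ʳ_) σ-injective i j _)) refl

      classWeight-permute : ∀ k → classWeight (c ∘ (σ ⟨$⟩ʳ_)) (w ∘ (σ ⟨$⟩ʳ_)) k ≈ classWeight c w k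
      classWeight-permute k = sym (sum-permute (λ z → δ (c z) k (w z)) σ)

      permute-surjective : StrictlySurjective _≡_ c → StrictlySurjective _≡_ (c ∘ (σ ⟨$⟩ʳ_))
      permute-surjective surj k with surj k
      ... | z , cz≡k = σ ⟨$⟩ˡ z , ≡.trans (≡.cong c (Perm.inverseʳ σ)) cz≡k

      classSize-permute : ∀ k → classSize (c ∘ (σ ⟨$⟩ʳ_)) k ≡ classSize c k
      classSize-permute k = ≡.sym (Indicator.sum-permute (λ z → 𝟙 (c z ≟ k)) σ)

    det-blowup-collision : ∀ {n} (c : Fin (suc (suc n)) → Fin K) w → StrictlySurjective _≡_ c →
      ∀ {u v} → u ≢ v → c u ≡ c v →
      (∀ (c′ : Fin (suc n) → Fin K) w′ → StrictlySurjective _≡_ c′ → Factorises c′ w′) →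
      Factorises c w
    det-blowup-collision {n} c w surj u≢v cu≡cv IH with moveToFront u≢v
    ... | σ , σ0≡u , σ1≡v = begin
      det N (blowup c w)                                ≈⟨ permutation-detInvariant σ (blowup c w) ⟨
      det N (λ i j → blowup c w (σ ⟨$⟩ʳ i) (σ ⟨$⟩ʳ j))  ≈⟨ det-cong N (blowup-permute c w σ) ⟨
      det N (blowup c′ w′)
        ≈⟨ det-blowup-twins c′ w′ c′0≡c′1
             (IH (c′ ∘ suc) (mergeFirstTwo w′) (tail-surjective c′ w′ c′0≡c′1 (permute-surjective c w σ surj))) ⟩
      multiplicityFactor c′ * det K (quotient (classWeight c′ w′))
        ≈⟨ *-cong (multiplicityFactor-cong c′ c (classSize-permute c w σ)) (det-quotient-cong (classWeight-permute c w σ)) ⟩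
      multiplicityFactor c * det K (quotient (classWeight c w)) ∎
      where
      N = suc (suc n)
      c′ = c ∘ (σ ⟨$⟩ʳ_)
      w′ = w ∘ (σ ⟨$⟩ʳ_)
      c′0≡c′1 : c′ zero ≡ c′ (suc zero)
      c′0≡c′1 = ≡.trans (≡.cong c σ0≡u) (≡.trans cu≡cv (≡.cong c (≡.sym σ1≡v)))

    det-blowup : ∀ N (c : Fin N → Fin K) w → StrictlySurjective _≡_ c → Factorises c w
    det-blowup N c w surj with injective-or-collision c
    ... | inj₁ inj = det-blowup-bijective c w (Perm.↔⇒≡ π) inj surj
      where
      π = Perm.permutation c (proj₁ ∘ surj) (proj₂ ∘ surj) (λ z → inj (proj₂ (surj (c z))))
    det-blowup (suc zero)    c w surj | inj₂ (zero , zero , 0≢0 , _) = ⊥-elim (0≢0 ≡.refl)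
    det-blowup (suc (suc n)) c w surj | inj₂ (u , v , u≢v , cu≡cv) =
      det-blowup-collision c w surj u≢v cu≡cv (det-blowup (suc n))


module CharacteristicPolynomial where

  open PolynomialRing
  open import Data.Nat using (ℕ; zero; suc; _∸_; s≤s)
  import Data.Nat.Properties as ℕ
  import Data.Nat as ℕ
  open import Data.Integer using (ℤ; +_; -_; _+_; _*_; _-_)
  open import Data.Integer.Solver using (module +-*-Solver)
  import Data.Integer.Properties as ℤ
  open import Data.Fin using (Fin; toℕ; _≟_; _↑ˡ_; _↑ʳ_)
  open import Data.Fin.Properties using (toℕ<n; toℕ-↑ˡ; toℕ-↑ʳ)
  open import Data.List using ([]; map; applyUpTo)
  open import Data.List.Properties using (map-applyUpTo)
  open import Data.Bool using (if_then_else_)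
  open import Function using (id; _∘_)
  open import Function.Definitions using (StrictlySurjective)
  open import Relation.Nullary using (yes; no)
  open import Relation.Nullary.Decidable using (⌊_⌋)
  open import Relation.Binary.PropositionalEquality hiding ([_])

  open Indicator using (𝟙)

  open Determinant Poly-commutativeRing
  open EquitablePartition Poly-commutativeRing
  module P = CommutativeRing Poly-commutativeRing
  open import Algebra.Properties.CommutativeMonoid.Sum P.+-commutativeMonoid using (sum; sum-cong-≋)
  open import Algebra.Properties.CommutativeMonoid.Sum P.*-commutativeMonoid using () renaming (sum to ∏; sum-cong-≋ to ∏-cong)
  open import Algebra.Properties.Semiring.Exp P.semiring using (_^_)
  open ≋-Reasoning

  sumFin≋sum : ∀ n (f : Fin n → Poly) → sumFin n f ≋ sum f
  sumFin≋sum zero    f = ≋-refl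
  sumFin≋sum (suc n) f = +P-congʳ (f Fin.zero) (sumFin≋sum n (f ∘ Fin.suc))

  constP-signZ≋sign : ∀ k → constP (signZ k) ≋ sign k
  constP-signZ≋sign zero          = ≋-refl
  constP-signZ≋sign (suc zero)    = ≋-refl
  constP-signZ≋sign (suc (suc k)) = constP-signZ≋sign k

  detP≋det : ∀ n (M : Fin n → Fin n → Poly) → detP n M ≋ det n M
  detP≋det zero    M = ≋-refl
  detP≋det (suc n) M = ≋-trans (sumFin≋sum (suc n) λ j → constP (signZ (toℕ j)) *P M Fin.zero j *P detP n (minor M j))
    (sum-cong-≋ λ j → P.*-cong (P.*-cong (constP-signZ≋sign (toℕ j)) (≋-refl {M Fin.zero j})) (detP≋det n (minor M j)))

  xI-_ : ∀ {n} → (Fin n → Fin n → ℤ) → Fin n → Fin n → Poly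
  (xI- A) i j = (if ⌊ i ≟ j ⌋ then X else []) +P negP (constP (A i j))

  charPoly-cong : ∀ {n} {M M′ : Fin n → Fin n → ℤ} → (∀ i j → M i j ≡ M′ i j) → charPoly M ≋ charPoly M′
  charPoly-cong {n} {M} {M′} M≡M′ = begin
    charPoly M      ≈⟨ detP≋det n (xI- M) ⟩
    det n (xI- M)   ≈⟨ det-cong n (λ i j → ≋-reflexive (cong (λ a → (xI- λ _ _ → a) i j) (M≡M′ i j))) ⟩
    det n (xI- M′)  ≈⟨ detP≋det n (xI- M′) ⟨
    charPoly M′     ∎

  ^≋^P : ∀ q m → q ^ m ≋ q ^P m
  ^≋^P q zero    = ≋-refl
  ^≋^P q (suc m) = *P-congʳ q (^≋^P q m)

  ∑-constP : ∀ {n} (f : Fin n → ℕ) → sum (λ z → constP (+ f z)) ≋ constP (+ Indicator.sum f)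
  ∑-constP {zero}  f = ≋-sym 0∷[]≋[]
  ∑-constP {suc n} f = +P-congʳ (constP (+ f Fin.zero)) (∑-constP (f ∘ Fin.suc))

  module BlockConstant {N K} (c : Fin N → Fin K) (c-surjective : StrictlySurjective _≡_ c)
    (e : Fin K → ℤ) (B : Fin K → Fin K → ℤ) where

    eigenvalue : Fin K → ℤ
    eigenvalue k = e k - B k k

    linearFactor : Fin K → Poly
    linearFactor k = X +P negP (constP (eigenvalue k))

    private module Q = Blowup +P-double≋[]⇒≋[] linearFactor (λ k l → constP (B k l))
    open Q public using (classSize)

    quotientℤ : Fin K → Fin K → ℤ
    quotientℤ k l = (if ⌊ k ≟ l ⌋ then eigenvalue k else + 0) + B k l * + classSize c l

    charPoly-blockConstant : (M : Fin N → Fin N → ℤ) →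
      (∀ i → M i i ≡ e (c i)) → (∀ {i j} → i ≢ j → M i j ≡ B (c i) (c j)) →
      charPoly M ≋ ∏ (λ k → linPow (eigenvalue k) (classSize c k ∸ 1)) *P charPoly quotientℤ
    charPoly-blockConstant M M-diagonal M-offDiagonal = begin
      charPoly M                                                        ≈⟨ detP≋det N (xI- M) ⟩
      det N (xI- M)                                                     ≈⟨ det-cong N entry≋blowup ⟩
      det N (blowup c w)                                                ≈⟨ det-blowup N c w c-surjective ⟩
      multiplicityFactor c *P det K (quotient (classWeight c w))
        ≈⟨ P.*-cong (∏-cong λ k → ^≋^P (linearFactor k) (classSize c k ∸ 1)) (det-quotient-cong classWeight≋classSize) ⟩
      ∏ (λ k → linPow (eigenvalue k) (classSize c k ∸ 1)) *P det K (quotient (constP ∘ +_ ∘ classSize c))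
        ≈⟨ P.*-cong (≋-refl {factor}) (det-cong K quotient≋entry) ⟩
      ∏ (λ k → linPow (eigenvalue k) (classSize c k ∸ 1)) *P det K (xI- quotientℤ) ≈⟨ P.*-cong (≋-refl {factor}) (detP≋det K (xI- quotientℤ)) ⟨
      ∏ (λ k → linPow (eigenvalue k) (classSize c k ∸ 1)) *P charPoly quotientℤ ∎
      where
      open Q
      open +-*-Solver
      factor = ∏ {K} λ k → linPow (eigenvalue k) (classSize c k ∸ 1)
      w : Fin N → Poly
      w _ = oneP
      -- Both sides are coefficient lists of length at most 2 with the same linear coefficient.
      entry≋blowup : ∀ i j → (xI- M) i j ≋ blowup c w i j
      entry≋blowup i j with i ≟ j
      ... | yes refl rewrite M-diagonal i = ∷-cong (solve 2 (λ x b → con (+ 0) :+ con (- + 1) :* x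
                                                            := (con (+ 0) :+ con (- + 1) :* (x :- b)) :+ con (- + 1) :* (b :* con (+ 1) :+ con (+ 0)))
                                                         refl (e (c i)) (B (c i) (c i))) ≋-refl
      ... | no i≢j =
        ∷-cong (cong (- + 1 *_) (trans (M-offDiagonal i≢j) (sym (trans (ℤ.+-identityʳ _) (ℤ.*-identityʳ _))))) ≋-refl
      δ-oneP : ∀ {n} (i j : Fin n) → δ i j oneP ≋ constP (+ 𝟙 (i ≟ j))
      δ-oneP i j with i ≟ j
      ... | yes _ = ≋-refl
      ... | no  _ = ≋-sym 0∷[]≋[]
      classWeight≋classSize : ∀ l → classWeight c w l ≋ constP (+ classSize c l)
      classWeight≋classSize l = ≋-trans (sum-cong-≋ λ z → δ-oneP (c z) l) (∑-constP λ z → 𝟙 (c z ≟ l))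
      quotient≋entry : ∀ k l → quotient (constP ∘ +_ ∘ classSize c) k l ≋ (xI- quotientℤ) k l
      quotient≋entry k l with k ≟ l
      ... | yes refl = ∷-cong (solve 2 (λ λ₀ y → (con (+ 0) :+ con (- + 1) :* λ₀) :+ con (- + 1) :* (y :+ con (+ 0))
                                           := con (+ 0) :+ con (- + 1) :* (λ₀ :+ y))
                                        refl (eigenvalue k) (B k k * + classSize c k)) ≋-refl
      ... | no  _    = ∷-cong (cong (- + 1 *_) (trans (ℤ.+-identityʳ (B k l * + classSize c l)) (sym (ℤ.+-identityˡ _)))) ≋-refl

  ∏-++ : ∀ m n (f : Fin (m ℕ.+ n) → Poly) → ∏ f ≋ ∏ (λ k → f (k ↑ˡ n)) *P ∏ (λ k → f (m ↑ʳ k))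
  ∏-++ zero    n f = ≋-sym (*P-identityˡ (∏ f))
  ∏-++ (suc m) n f = begin
    f Fin.zero *P ∏ (f ∘ Fin.suc)                                               ≈⟨ *P-congʳ (f Fin.zero) (∏-++ m n (f ∘ Fin.suc)) ⟩
    f Fin.zero *P (∏ (λ k → f (Fin.suc (k ↑ˡ n))) *P ∏ (λ k → f (suc m ↑ʳ k)))  ≈⟨ *P-assoc (f Fin.zero) _ _ ⟨
    (f Fin.zero *P ∏ (λ k → f (Fin.suc (k ↑ˡ n)))) *P ∏ (λ k → f (suc m ↑ʳ k))  ∎

  ∏-toℕ : ∀ m (g : ℕ → Poly) → ∏ {m} (g ∘ toℕ) ≋ prodP (applyUpTo g m)
  ∏-toℕ zero    g = ≋-refl
  ∏-toℕ (suc m) g = *P-congʳ (g 0) (∏-toℕ m (g ∘ suc))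

  prodP-range : ∀ (F : ℕ → Poly) lo hi → prodP (map F (range lo hi)) ≡ prodP (applyUpTo (F ∘ (lo ℕ.+_)) (suc hi ∸ lo))
  prodP-range F lo hi = cong prodP (trans (cong (map F) (map-applyUpTo id (lo ℕ.+_) (suc hi ∸ lo))) (map-applyUpTo (lo ℕ.+_) F _))

  ∏-ranges : ∀ b (f : Fin (2 ℕ.* b) → Poly) (F₁ F₂ : ℕ → Poly) →
    (∀ k → suc (toℕ k) ℕ.≤ b → f k ≋ F₁ (suc (toℕ k))) →
    (∀ k → b ℕ.< suc (toℕ k) → f k ≋ F₂ (suc (toℕ k))) →
    ∏ f ≋ prodP (map F₁ (range 1 b)) *P prodP (map F₂ (range (suc b) (2 ℕ.* b)))
  ∏-ranges b f F₁ F₂ f≋F₁ f≋F₂ = begin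
    ∏ f                                                                   ≈⟨ ∏-++ b (b ℕ.+ 0) f ⟩
    ∏ {b} (λ k → f (k ↑ˡ (b ℕ.+ 0))) *P ∏ {b ℕ.+ 0} (λ k → f (b ↑ʳ k))
      ≈⟨ P.*-cong (∏-cong {b} lower) (∏-cong {b ℕ.+ 0} upper) ⟩
    ∏ {b} (λ k → F₁ (1 ℕ.+ toℕ k)) *P ∏ {b ℕ.+ 0} (λ k → F₂ (suc b ℕ.+ toℕ k))
      ≈⟨ P.*-cong (∏-toℕ b (F₁ ∘ (1 ℕ.+_))) (∏-toℕ (b ℕ.+ 0) (F₂ ∘ (suc b ℕ.+_))) ⟩
    prodP (applyUpTo (F₁ ∘ (1 ℕ.+_)) b) *P prodP (applyUpTo (F₂ ∘ (suc b ℕ.+_)) (b ℕ.+ 0))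
      ≡⟨ cong₂ _*P_ (sym (prodP-range F₁ 1 b))
                    (sym (trans (prodP-range F₂ (suc b) (2 ℕ.* b)) (cong (prodP ∘ applyUpTo (F₂ ∘ (suc b ℕ.+_))) (ℕ.m+n∸m≡n b (b ℕ.+ 0))))) ⟩
    prodP (map F₁ (range 1 b)) *P prodP (map F₂ (range (suc b) (2 ℕ.* b))) ∎
    where
    lower : ∀ k → f (k ↑ˡ (b ℕ.+ 0)) ≋ F₁ (1 ℕ.+ toℕ k)
    lower k = ≋-trans (f≋F₁ _ (subst (λ i → suc i ℕ.≤ b) (sym (toℕ-↑ˡ k (b ℕ.+ 0))) (toℕ<n k)))
                      (≋-reflexive (cong (F₁ ∘ suc) (toℕ-↑ˡ k _)))
    upper : ∀ k → f (b ↑ʳ k) ≋ F₂ (suc b ℕ.+ toℕ k)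
    upper k = ≋-trans (f≋F₂ _ (subst (λ i → b ℕ.< suc i) (sym (toℕ-↑ʳ b k)) (s≤s (ℕ.m≤m+n b (toℕ k)))))
                      (≋-reflexive (cong (F₂ ∘ suc) (toℕ-↑ʳ b k)))


module Valuation where

  open import Data.Nat using (ℕ; zero; suc; _+_; _*_; _∸_; _≤_; _<_; z≤n; s≤s; _≤?_; _<?_; >-nonZero; nonTrivial⇒n>1)
  open import Data.Nat.Properties
  open import Data.Nat.Divisibility using (_∣_; _∣0; ∣⇒≤)
  open import Data.Nat.Primality using (Prime; euclidsLemma; prime⇒nonTrivial)
  open import Data.Fin using (Fin; fromℕ<)
  open import Data.Fin.Properties using (toℕ<n; toℕ-fromℕ<)
  open import Data.Vec using (Vec; []; _∷_; replicate)
  open import Data.List using (applyUpTo)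
  open import Data.List.Properties using (map-applyUpTo)
  open import Data.Product using (Σ; _×_; _,_; proj₁; proj₂)
  open import Data.Sum using ([_,_]′)
  open import Data.Empty using (⊥-elim)
  open import Function using (_∘_)
  open import Function.Bundles using (_⇔_; mk⇔; Equivalence)
  open import Relation.Nullary using (¬_; yes; no)
  open import Relation.Nullary.Decidable using (⌊_⌋; does-⇔; isYes≗does)
  open import Relation.Binary.PropositionalEquality

  -- The index of the lowest nonzero coefficient; the length m for the zero vector.
  val : ∀ {p m} → Vec (Fin p) m → ℕ
  val []               = 0
  val (Fin.zero  ∷ v) = suc (val v)
  val (Fin.suc _ ∷ v) = 0

  coef-<val : ∀ {p m} (x : Vec (Fin p) m) {i} → i < val x → coef x i ≡ 0
  coef-<val (Fin.zero ∷ v) {zero}  _         = refl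
  coef-<val (Fin.zero ∷ v) {suc i} (s≤s i<v) = coef-<val v i<v

  coef-val : ∀ {p m} (x : Vec (Fin p) m) → val x < m → 0 < coef x (val x) × coef x (val x) < p
  coef-val (Fin.zero  ∷ v) (s≤s v<m) = coef-val v v<m
  coef-val (Fin.suc a ∷ v) _         = s≤s z≤n , toℕ<n (Fin.suc a)

  coef-≥length : ∀ {p m} (x : Vec (Fin p) m) {i} → m ≤ i → coef x i ≡ 0
  coef-≥length []      _         = refl
  coef-≥length (a ∷ x) (s≤s m≤i) = coef-≥length x m≤i

  val≤length : ∀ {p m} (x : Vec (Fin p) m) → val x ≤ m
  val≤length []               = z≤n
  val≤length (Fin.zero  ∷ v) = s≤s (val≤length v)
  val≤length (Fin.suc a ∷ v) = z≤n

  nonzero⇔val<length : ∀ {p m} (x : Vec (Fin p) m) → (¬ (∀ k → coef x k ≡ 0)) ⇔ (val x < m)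
  nonzero⇔val<length {m = m} x = mk⇔ nonzero⇒val< val<⇒nonzero
    where
    nonzero⇒val< : ¬ (∀ k → coef x k ≡ 0) → val x < m
    nonzero⇒val< x≢0 with val x <? m
    ... | yes v<m = v<m
    ... | no  v≮m = ⊥-elim (x≢0 λ k →
      [ coef-≥length x , (λ k<m → coef-<val x (<-≤-trans k<m (≮⇒≥ v≮m))) ]′ (≤-<-connex m k))
    val<⇒nonzero : val x < m → ¬ (∀ k → coef x k ≡ 0)
    val<⇒nonzero v<m x≡0 = <-irrefl (sym (x≡0 (val x))) (proj₁ (coef-val x v<m))

  sumN-applyUpTo-zero : ∀ n (g : ℕ → ℕ) → (∀ i → i < n → g i ≡ 0) → sumN (applyUpTo g n) ≡ 0
  sumN-applyUpTo-zero zero    g _   = refl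
  sumN-applyUpTo-zero (suc n) g g≡0 =
    cong₂ _+_ (g≡0 0 (s≤s z≤n)) (sumN-applyUpTo-zero n (g ∘ suc) λ i i<n → g≡0 (suc i) (s≤s i<n))

  sumN-applyUpTo-single : ∀ n (g : ℕ → ℕ) {i₀} → i₀ < n → (∀ i → i < n → i ≢ i₀ → g i ≡ 0) →
    sumN (applyUpTo g n) ≡ g i₀
  sumN-applyUpTo-single (suc n) g {zero}   _          g≡0 =
    trans (cong (g 0 +_) (sumN-applyUpTo-zero n (g ∘ suc) λ i i<n → g≡0 (suc i) (s≤s i<n) λ ())) (+-identityʳ _)
  sumN-applyUpTo-single (suc n) g {suc i₀} (s≤s i₀<n) g≡0 =
    cong₂ _+_ (g≡0 0 (s≤s z≤n) λ ())
      (sumN-applyUpTo-single n (g ∘ suc) i₀<n λ i i<n i≢i₀ → g≡0 (suc i) (s≤s i<n) (i≢i₀ ∘ suc-injective))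

  module _ {p m} (x y : Vec (Fin p) m) where

    private
      term : ℕ → ℕ → ℕ
      term k i = coef x i * coef y (k ∸ i)

    mulCoeff-applyUpTo : ∀ k → mulCoeff x y k ≡ sumN (applyUpTo (term k) (suc k))
    mulCoeff-applyUpTo k = cong sumN (map-applyUpTo (λ i → i) (term k) (suc k))

    term-vanishes : ∀ {k i} → i ≤ k → (val x ≤ i → k < i + val y) → term k i ≡ 0
    term-vanishes {k} {i} i≤k k<i+vy with i <? val x
    ... | yes i<vx = cong (_* coef y (k ∸ i)) (coef-<val x i<vx)
    ... | no  i≮vx = trans (cong (coef x i *_) (coef-<val y k∸i<vy)) (*-zeroʳ (coef x i))
      where
      k∸i<vy : k ∸ i < val y
      k∸i<vy = subst (k ∸ i <_) (m+n∸m≡n i (val y)) (∸-monoˡ-< (k<i+vy (≮⇒≥ i≮vx)) i≤k)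

    mulCoeff-<val : ∀ {k} → k < val x + val y → mulCoeff x y k ≡ 0
    mulCoeff-<val {k} k<vx+vy = trans (mulCoeff-applyUpTo k) (sumN-applyUpTo-zero (suc k) (term k) λ where
      i (s≤s i≤k) → term-vanishes i≤k λ vx≤i → <-≤-trans k<vx+vy (+-monoˡ-≤ (val y) vx≤i))

    mulCoeff-val : mulCoeff x y (val x + val y) ≡ coef x (val x) * coef y (val y)
    mulCoeff-val = begin
      mulCoeff x y (val x + val y)                             ≡⟨ mulCoeff-applyUpTo (val x + val y) ⟩
      sumN (applyUpTo (term (val x + val y)) (suc (val x + val y)))
        ≡⟨ sumN-applyUpTo-single _ _ (s≤s (m≤m+n (val x) (val y))) (λ where
             i (s≤s i≤k) i≢vx → term-vanishes i≤k λ vx≤i → +-monoˡ-< (val y) (≤∧≢⇒< vx≤i (i≢vx ∘ sym))) ⟩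
      coef x (val x) * coef y (val x + val y ∸ val x)          ≡⟨ cong (λ j → coef x (val x) * coef y j) (m+n∸m≡n (val x) (val y)) ⟩
      coef x (val x) * coef y (val y)                          ∎
      where open ≡-Reasoning

  module _ {p} (p-prime : Prime p) (b : ℕ) (x y : Elem p b) where

    ProdZero⇔val : ProdZero p b x y ⇔ (suc (2 * b) ≤ val x + val y)
    ProdZero⇔val = mk⇔ ProdZero⇒ ⇒ProdZero
      where
      ⇒ProdZero : suc (2 * b) ≤ val x + val y → ProdZero p b x y
      ⇒ProdZero 2b<v k = subst (p ∣_) (sym (mulCoeff-<val x y (<-≤-trans (toℕ<n k) 2b<v))) (p ∣0)
      p∤ : ∀ {a} → 0 < a → a < p → ¬ (p ∣ a)
      p∤ 0<a a<p p∣a = <⇒≱ a<p (∣⇒≤ ⦃ >-nonZero 0<a ⦄ p∣a)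
      -- Otherwise the coefficient of degree val x + val y is the product of the two lowest
      -- coefficients, which p does not divide.
      ProdZero⇒ : ProdZero p b x y → suc (2 * b) ≤ val x + val y
      ProdZero⇒ xy≡0 with suc (2 * b) ≤? val x + val y
      ... | yes 2b<v = 2b<v
      ... | no  2b≮v = ⊥-elim ([ p∤ (proj₁ x-val) (proj₂ x-val) , p∤ (proj₁ y-val) (proj₂ y-val) ]′
                                 (euclidsLemma (coef x (val x)) (coef y (val y)) p-prime p∣lowest))
        where
        v<2b+1 : val x + val y < suc (2 * b)
        v<2b+1 = ≰⇒> 2b≮v
        x-val = coef-val x (≤-<-trans (m≤m+n (val x) (val y)) v<2b+1)
        y-val = coef-val y (≤-<-trans (m≤n+m (val y) (val x)) v<2b+1)
        p∣lowest : p ∣ coef x (val x) * coef y (val y)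
        p∣lowest = subst (p ∣_) (trans (cong (mulCoeff x y) (toℕ-fromℕ< v<2b+1)) (mulCoeff-val x y)) (xy≡0 (fromℕ< v<2b+1))

    prodZero?-val : ⌊ prodZero? p b x y ⌋ ≡ ⌊ suc (2 * b) ≤? val x + val y ⌋
    prodZero?-val = trans (isYes≗does (prodZero? p b x y))
      (trans (does-⇔ ProdZero⇔val (prodZero? p b x y) (suc (2 * b) ≤? val x + val y)) (sym (isYes≗does _)))

  -- The monomial x^i.
  ∃-val : ∀ {p} → 2 ≤ p → ∀ {m i} → i < m → Σ (Vec (Fin p) m) λ x → val x ≡ i
  ∃-val {suc (suc q)} _ {suc m} {zero}  _         = Fin.suc Fin.zero ∷ replicate m Fin.zero , refl
  ∃-val {suc (suc q)} _ {suc m} {suc i} (s≤s i<m) with ∃-val (s≤s (s≤s z≤n)) i<m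
  ... | v , val-v≡i = Fin.zero ∷ v , cong suc val-v≡i
  ∃-val {suc zero} (s≤s ())

  prime⇒2≤ : ∀ {p} → Prime p → 2 ≤ p
  prime⇒2≤ {p} p-prime = nonTrivial⇒n>1 p ⦃ prime⇒nonTrivial p-prime ⦄

  module _ {p} (p-prime : Prime p) (b : ℕ) where

    IsVertex⇔val : ∀ x → IsVertex p b x ⇔ (1 ≤ val x × val x ≤ 2 * b)
    IsVertex⇔val x = mk⇔ vertex⇒ ⇒vertex
      where
      vertex⇒ : IsVertex p b x → 1 ≤ val x × val x ≤ 2 * b
      vertex⇒ (x≢0 , y , y≢0 , xy≡0) = 1≤val , ≤-pred (Equivalence.to (nonzero⇔val<length x) x≢0)
        where
        1≤val : 1 ≤ val x
        1≤val with val x in val-x≡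
        ... | suc _ = s≤s z≤n
        ... | zero  = ⊥-elim (<⇒≱ (Equivalence.to (nonzero⇔val<length y) y≢0)
                        (subst (λ v → suc (2 * b) ≤ v + val y) val-x≡ (Equivalence.to (ProdZero⇔val p-prime b x y) xy≡0)))
      ⇒vertex : 1 ≤ val x × val x ≤ 2 * b → IsVertex p b x
      ⇒vertex (1≤val , val≤2b) with ∃-val (prime⇒2≤ p-prime) {suc (2 * b)} {2 * b} ≤-refl
      ... | y , val-y≡2b = Equivalence.from (nonzero⇔val<length x) (s≤s val≤2b)
                         , y , Equivalence.from (nonzero⇔val<length y) (s≤s (≤-reflexive val-y≡2b))
                         , Equivalence.from (ProdZero⇔val p-prime b x y)
                             (subst (λ v → suc (2 * b) ≤ val x + v) (sym val-y≡2b) (+-monoˡ-≤ (2 * b) 1≤val))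


module Counting where

  open import Data.Nat using (ℕ; zero; suc; _+_; _*_; _∸_; _^_; _⊓_; _≤_; _<_; z≤n; s≤s; _≤?_)
  open import Data.Nat.Properties hiding (_≟_)
  import Data.Nat as ℕ
  open import Data.Fin using (Fin; toℕ; _≟_)
  open import Data.Vec using (Vec; []; _∷_)
  open import Data.Vec.Properties using (≡-dec)
  open import Function using (_∘_)
  open import Relation.Nullary using (Dec; yes; no)
  open import Relation.Binary.PropositionalEquality
  open import Algebra.Properties.Semiring.Sum +-*-semiring using (*-distribˡ-sum)

  open Indicator
  open Valuation using (val)

  _≟ᵥ_ : ∀ {p m} (x y : Vec (Fin p) m) → Dec (x ≡ y)
  _≟ᵥ_ = ≡-dec _≟_

  ∑ᵛ : ∀ {p} m → (Vec (Fin p) m → ℕ) → ℕ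
  ∑ᵛ zero    f = f []
  ∑ᵛ (suc m) f = sum λ a → ∑ᵛ m λ v → f (a ∷ v)

  ∑ᵛ-cong : ∀ {p} m {f g : Vec (Fin p) m → ℕ} → (∀ x → f x ≡ g x) → ∑ᵛ m f ≡ ∑ᵛ m g
  ∑ᵛ-cong     zero    f≗g = f≗g []
  ∑ᵛ-cong {p} (suc m) f≗g = sum-cong-≗ {p} λ a → ∑ᵛ-cong m λ v → f≗g (a ∷ v)

  ∑ᵛ-const : ∀ {p} m c → ∑ᵛ {p} m (λ _ → c) ≡ p ^ m * c
  ∑ᵛ-const         zero    c = sym (+-identityʳ c)
  ∑ᵛ-const {p} (suc m) c = begin
    sum {p} (λ _ → ∑ᵛ {p} m λ _ → c)  ≡⟨ sum-cong-≗ {p} (λ _ → ∑ᵛ-const {p} m c) ⟩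
    sum {p} (λ _ → p ^ m * c)         ≡⟨ ∑-const p (p ^ m * c) ⟩
    p * (p ^ m * c)                   ≡⟨ *-assoc p (p ^ m) c ⟨
    p ^ suc m * c                     ∎
    where open ≡-Reasoning

  ∑ᵛ-zero : ∀ {p} m {f : Vec (Fin p) m → ℕ} → (∀ x → f x ≡ 0) → ∑ᵛ m f ≡ 0
  ∑ᵛ-zero {p} m f≡0 = trans (∑ᵛ-cong m f≡0) (trans (∑ᵛ-const {p} m 0) (*-zeroʳ (p ^ m)))

  ∑ᵛ-*ˡ : ∀ {p} m c (f : Vec (Fin p) m → ℕ) → ∑ᵛ m (λ x → c * f x) ≡ c * ∑ᵛ m f
  ∑ᵛ-*ˡ     zero    c f = refl
  ∑ᵛ-*ˡ {p} (suc m) c f =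
    trans (sum-cong-≗ {p} λ a → ∑ᵛ-*ˡ m c (f ∘ (a ∷_))) (sym (*-distribˡ-sum c λ a → ∑ᵛ m (f ∘ (a ∷_))))

  ∑ᵛ-comm : ∀ {p} m {n} (h : Vec (Fin p) m → Fin n → ℕ) →
    ∑ᵛ m (λ x → sum (h x)) ≡ sum (λ z → ∑ᵛ m λ x → h x z)
  ∑ᵛ-comm     zero    h = refl
  ∑ᵛ-comm {p} (suc m) h =
    trans (sum-cong-≗ {p} λ a → ∑ᵛ-comm m (h ∘ (a ∷_))) (∑-comm λ a z → ∑ᵛ m λ v → h (a ∷ v) z)

  𝟙-≟ᵥ-∷ : ∀ {p m} (a b : Fin p) (v w : Vec (Fin p) m) →
    𝟙 ((a ∷ v) ≟ᵥ (b ∷ w)) ≡ 𝟙 (a ≟ b) * 𝟙 (v ≟ᵥ w)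
  𝟙-≟ᵥ-∷ a b v w with a ≟ b | v ≟ᵥ w
  ... | yes _ | yes _ = refl
  ... | yes _ | no  _ = refl
  ... | no  _ | yes _ = refl
  ... | no  _ | no  _ = refl

  ∑ᵛ-𝟙≟ᵥ-* : ∀ {p} m (y : Vec (Fin p) m) (g : Vec (Fin p) m → ℕ) → ∑ᵛ m (λ x → 𝟙 (x ≟ᵥ y) * g x) ≡ g y
  ∑ᵛ-𝟙≟ᵥ-*         zero    []      g = +-identityʳ (g [])
  ∑ᵛ-𝟙≟ᵥ-* {p} (suc m) (b ∷ y) g = begin
    sum {p} (λ a → ∑ᵛ m λ v → 𝟙 ((a ∷ v) ≟ᵥ (b ∷ y)) * g (a ∷ v))
      ≡⟨ sum-cong-≗ {p} (λ a → ∑ᵛ-cong m λ v → trans (cong (_* g (a ∷ v)) (𝟙-≟ᵥ-∷ a b v y)) (*-assoc (𝟙 (a ≟ b)) _ _)) ⟩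
    sum {p} (λ a → ∑ᵛ m λ v → 𝟙 (a ≟ b) * (𝟙 (v ≟ᵥ y) * g (a ∷ v)))
      ≡⟨ sum-cong-≗ {p} (λ a → trans (∑ᵛ-*ˡ m (𝟙 (a ≟ b)) _) (cong (𝟙 (a ≟ b) *_) (∑ᵛ-𝟙≟ᵥ-* m y (g ∘ (a ∷_))))) ⟩
    sum {p} (λ a → 𝟙 (a ≟ b) * g (a ∷ y))
      ≡⟨ ∑-𝟙≟-* b (λ a → g (a ∷ y)) ⟩
    g (b ∷ y) ∎
    where open ≡-Reasoning

  -- Split by the first coefficient: the p - 1 nonzero ones give valuation 0.
  ∑ᵛ-𝟙-val : ∀ {p} m {i} → i < m → ∑ᵛ {p} m (λ x → 𝟙 (val x ℕ.≟ i)) ≡ (p ∸ 1) * p ^ (m ∸ suc i)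
  ∑ᵛ-𝟙-val {zero}  (suc m) _ = refl
  ∑ᵛ-𝟙-val {suc q} (suc m) {zero} _ = begin
    ∑ᵛ m (λ v → 𝟙 (suc (val v) ℕ.≟ 0)) + sum {q} (λ a → ∑ᵛ m λ _ → 1)
      ≡⟨ cong₂ _+_ (∑ᵛ-zero m λ v → 𝟙-no (suc (val v) ℕ.≟ 0) λ ()) (sum-cong-≗ {q} λ _ → ∑ᵛ-const m 1) ⟩
    sum {q} (λ _ → suc q ^ m * 1)
      ≡⟨ trans (∑-const q _) (cong (q *_) (*-identityʳ _)) ⟩
    q * suc q ^ m ∎
    where open ≡-Reasoning
  ∑ᵛ-𝟙-val {suc q} (suc m) {suc i} (s≤s i<m) = begin
    ∑ᵛ m (λ v → 𝟙 (suc (val v) ℕ.≟ suc i)) + sum {q} (λ a → ∑ᵛ m λ _ → 𝟙 (0 ℕ.≟ suc i))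
      ≡⟨ cong₂ _+_ (∑ᵛ-cong m λ v → 𝟙-cong suc-injective (cong suc) (suc (val v) ℕ.≟ suc i) (val v ℕ.≟ i))
                   (∑-zero {q} _ λ _ → ∑ᵛ-zero m λ _ → refl) ⟩
    ∑ᵛ m (λ v → 𝟙 (val v ℕ.≟ i)) + 0
      ≡⟨ trans (+-identityʳ _) (∑ᵛ-𝟙-val m i<m) ⟩
    q * suc q ^ (m ∸ suc i) ∎
    where open ≡-Reasoning

  -- The classes k ≥ m - t have sizes (p-1) p^(m-1-k), which telescope to p^t - 1.
  ∑-geometric : ∀ {p} → 1 ≤ p → ∀ m t →
    sum {m} (λ k → 𝟙 (suc m ≤? t + suc (toℕ k)) * ((p ∸ 1) * p ^ (m ∸ suc (toℕ k)))) + 1 ≡ p ^ (t ⊓ m)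
  ∑-geometric {suc q} _ zero    t = cong (suc q ^_) (sym (⊓-zeroʳ t))
  ∑-geometric {suc q} _ (suc m) t = begin
    first + rest + 1         ≡⟨ cong (λ s → first + s + 1) rest≡ ⟩
    first + ∑ m + 1          ≡⟨ +-assoc first (∑ m) 1 ⟩
    first + (∑ m + 1)        ≡⟨ cong (first +_) (∑-geometric (s≤s z≤n) m t) ⟩
    first + suc q ^ (t ⊓ m)  ≡⟨ last-step ⟩
    suc q ^ (t ⊓ suc m)      ∎
    where
    open ≡-Reasoning
    ∑ : ∀ m → ℕ
    ∑ m = sum {m} λ k → 𝟙 (suc m ≤? t + suc (toℕ k)) * (q * suc q ^ (m ∸ suc (toℕ k)))
    first = 𝟙 (suc (suc m) ≤? t + 1) * (q * suc q ^ m)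
    rest = sum {m} λ k → 𝟙 (suc (suc m) ≤? t + suc (suc (toℕ k))) * (q * suc q ^ (m ∸ suc (toℕ k)))
    rest≡ : rest ≡ ∑ m
    rest≡ = sum-cong-≗ {m} λ k → cong (_* (q * suc q ^ (m ∸ suc (toℕ k))))
      (𝟙-cong (≤-pred ∘ subst (suc (suc m) ≤_) (+-suc t _)) (subst (suc (suc m) ≤_) (sym (+-suc t _)) ∘ s≤s)
               (suc (suc m) ≤? t + suc (suc (toℕ k))) (suc m ≤? t + suc (toℕ k)))
    first-≤ : t ≤ m → first ≡ 0
    first-≤ t≤m =
      cong (_* (q * suc q ^ m)) (𝟙-no (suc (suc m) ≤? t + 1) (<⇒≱ (s≤s (≤-trans (≤-reflexive (+-comm t 1)) (s≤s t≤m)))))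
    first-> : m < t → first ≡ q * suc q ^ m
    first-> m<t = trans (cong (_* (q * suc q ^ m)) (𝟙-yes (suc (suc m) ≤? t + 1) (≤-trans (s≤s m<t) (≤-reflexive (+-comm 1 t)))))
                        (+-identityʳ _)
    last-step : first + suc q ^ (t ⊓ m) ≡ suc q ^ (t ⊓ suc m)
    last-step with t ≤? m
    ... | yes t≤m = begin
      first + suc q ^ (t ⊓ m)    ≡⟨ cong₂ _+_ (first-≤ t≤m) (cong (suc q ^_) (m≤n⇒m⊓n≡m t≤m)) ⟩
      suc q ^ t                  ≡⟨ cong (suc q ^_) (m≤n⇒m⊓n≡m (m≤n⇒m≤1+n t≤m)) ⟨
      suc q ^ (t ⊓ suc m)        ∎
    ... | no t≰m = begin
      first + suc q ^ (t ⊓ m)    ≡⟨ cong₂ _+_ (first-> (≰⇒> t≰m)) (cong (suc q ^_) (m≥n⇒m⊓n≡n (<⇒≤ (≰⇒> t≰m)))) ⟩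
      q * suc q ^ m + suc q ^ m  ≡⟨ +-comm (q * suc q ^ m) _ ⟩
      suc q ^ suc m              ≡⟨ cong (suc q ^_) (m≥n⇒m⊓n≡n (≰⇒> t≰m)) ⟨
      suc q ^ (t ⊓ suc m)        ∎

module ZeroDivisorGraph where

  open import Data.Nat using (ℕ; zero; suc; _+_; _*_; _∸_; _^_; _⊓_; _≤_; _<_; z≤n; s≤s; _≤?_; >-nonZero)
  import Data.Nat as ℕ
  open import Data.Nat.Properties hiding (_≟_)
  open import Data.Nat.Primality using (Prime)
  open import Data.Integer using (ℤ; +_; _⊖_) renaming (_+_ to _+ℤ_; _-_ to _-ℤ_; _*_ to _*ℤ_)
  import Data.Integer.Properties as ℤ
  import Data.Fin as Fin
  open import Data.Fin using (Fin; toℕ; fromℕ<; _≟_)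
  open import Data.Fin.Properties using (toℕ<n; toℕ-fromℕ<; toℕ-injective)
  open import Data.Product using (∃; _×_; _,_; proj₁)
  open import Data.Empty using (⊥-elim)
  open import Data.Bool using (if_then_else_)
  open import Function using (_∘_)
  open import Function.Bundles using (Equivalence; _⇔_; mk⇔)
  open import Function.Definitions using (Injective; StrictlySurjective)
  open import Relation.Nullary using (Dec; yes; no; ¬_; ¬?)
  open import Relation.Nullary.Decidable using (⌊_⌋)
  open import Relation.Binary.PropositionalEquality

  open Indicator
  open Valuation
  open Counting

  -- Vertices x and y of valuations i and j are adjacent iff i + j ≥ 2b + 1.
  adjacency : ∀ b → Fin (2 * b) → Fin (2 * b) → ℕ
  adjacency b k l = 𝟙 (suc (2 * b) ≤? suc (toℕ k) + suc (toℕ l))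

  adjacency-diagonal-≤ : ∀ b (k : Fin (2 * b)) → suc (toℕ k) ≤ b → adjacency b k k ≡ 0
  adjacency-diagonal-≤ b k k<b = 𝟙-no (suc (2 * b) ≤? suc (toℕ k) + suc (toℕ k)) λ 2b<2k →
    <⇒≱ 2b<2k (≤-trans (+-mono-≤ k<b k<b) (≤-reflexive (cong (_+_ b) (sym (+-identityʳ b)))))

  adjacency-diagonal-> : ∀ b (k : Fin (2 * b)) → b < suc (toℕ k) → adjacency b k k ≡ 1
  adjacency-diagonal-> b k b<k = 𝟙-yes (suc (2 * b) ≤? suc (toℕ k) + suc (toℕ k))
    (≤-trans (≤-reflexive (cong suc (cong (_+_ b) (+-identityʳ b)))) (+-mono-≤ b<k (<⇒≤ b<k)))

  if-yes : ∀ {p a} {P : Set p} {A : Set a} (d : Dec P) {x y : A} → P → (if ⌊ d ⌋ then x else y) ≡ x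
  if-yes (yes _) _  = refl
  if-yes (no ¬p) p = ⊥-elim (¬p p)

  if-no : ∀ {p a} {P : Set p} {A : Set a} (d : Dec P) {x y : A} → ¬ P → (if ⌊ d ⌋ then x else y) ≡ y
  if-no (yes p) ¬p = ⊥-elim (¬p p)
  if-no (no _)  _  = refl

  if-⌊⌋-then-else : ∀ {p} {P : Set p} (d : Dec P) x → (if ⌊ d ⌋ then x else + 0) ≡ + 𝟙 d *ℤ x
  if-⌊⌋-then-else (yes _) x = sym (ℤ.*-identityˡ x)
  if-⌊⌋-then-else (no _)  x = sym (ℤ.*-zeroˡ x)

  sumZ-cong : ∀ n {f g : Fin n → ℤ} → (∀ z → f z ≡ g z) → sumZ n f ≡ sumZ n g
  sumZ-cong zero    _   = refl
  sumZ-cong (suc n) f≗g = cong₂ _+ℤ_ (f≗g Fin.zero) (sumZ-cong n (f≗g ∘ Fin.suc))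

  sumZ-+ : ∀ n (f : Fin n → ℕ) → sumZ n (λ z → + f z) ≡ + sum f
  sumZ-+ zero    f = refl
  sumZ-+ (suc n) f = cong (λ s → + f Fin.zero +ℤ s) (sumZ-+ n (f ∘ Fin.suc))

  module Enumeration {p} (p-prime : Prime p) (b : ℕ) {N} (e : Fin N → Elem p b)
    (e-injective : Injective _≡_ _≡_ e) (e-vertex : ∀ i → IsVertex p b (e i))
    (e-onto : ∀ x → IsVertex p b x → ∃ λ i → e i ≡ x) where

    private
      val-e : ∀ i → 1 ≤ val (e i) × val (e i) ≤ 2 * b
      val-e i = Equivalence.to (IsVertex⇔val p-prime b (e i)) (e-vertex i)

      val-e∸1<2b : ∀ i → val (e i) ∸ 1 < 2 * b
      val-e∸1<2b i with val (e i) | val-e i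
      ... | suc v | _ , v<2b = v<2b

    -- V_k of the paper, shifted to start at 0: class i = val (e i) - 1.
    class : Fin N → Fin (2 * b)
    class i = fromℕ< (val-e∸1<2b i)

    suc-class : ∀ i → suc (toℕ (class i)) ≡ val (e i)
    suc-class i = trans (cong suc (toℕ-fromℕ< (val-e∸1<2b i))) (suc-pred (val (e i)) ⦃ >-nonZero (proj₁ (val-e i)) ⦄)

    val≡⇒IsVertex : ∀ {k} x → val x ≡ suc (toℕ k) → IsVertex p b x
    val≡⇒IsVertex {k} x val-x≡ =
      Equivalence.from (IsVertex⇔val p-prime b x) (subst (λ v → 1 ≤ v × v ≤ 2 * b) (sym val-x≡) (s≤s z≤n , toℕ<n k))

    class≡⇔ : ∀ {i k} → (class i ≡ k) ⇔ (val (e i) ≡ suc (toℕ k))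
    class≡⇔ {i} = mk⇔ (λ { refl → sym (suc-class i) }) λ v≡k → toℕ-injective (suc-injective (trans (suc-class i) v≡k))

    class-surjective : StrictlySurjective _≡_ class
    class-surjective k with ∃-val (prime⇒2≤ p-prime) {suc (2 * b)} (s≤s (toℕ<n k))
    ... | x , val-x≡ with e-onto x (val≡⇒IsVertex x val-x≡)
    ...   | i , eᵢ≡x = i , Equivalence.from class≡⇔ (trans (cong val eᵢ≡x) val-x≡)

    ∑-vertices : (g : Elem p b → ℕ) → (∀ x → g x ≢ 0 → IsVertex p b x) → sum (g ∘ e) ≡ ∑ᵛ (suc (2 * b)) g
    ∑-vertices g g-vertex = begin
      sum (g ∘ e)                                ≡⟨ sum-cong-≗ {N} (λ z → sym (∑ᵛ-𝟙≟ᵥ-* {p} m (e z) g)) ⟩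
      sum (λ z → ∑ᵛ m λ x → 𝟙 (x ≟ᵥ e z) * g x)  ≡⟨ ∑ᵛ-comm {p} m (λ x z → 𝟙 (x ≟ᵥ e z) * g x) ⟨
      ∑ᵛ m (λ x → sum λ z → 𝟙 (x ≟ᵥ e z) * g x)  ≡⟨ ∑ᵛ-cong {p} m multiplicity ⟩
      ∑ᵛ m g                                     ∎
      where
      open ≡-Reasoning
      m = suc (2 * b)
      multiplicity : ∀ x → sum (λ z → 𝟙 (x ≟ᵥ e z) * g x) ≡ g x
      multiplicity x with g x ℕ.≟ 0
      ... | yes gx≡0 = trans (sum-cong-≗ {N} λ z → trans (cong (𝟙 (x ≟ᵥ e z) *_) gx≡0) (*-zeroʳ (𝟙 (x ≟ᵥ e z))))
                             (trans (∑-zero {N} (λ _ → 0) λ _ → refl) (sym gx≡0))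
      ... | no  gx≢0 with e-onto x (g-vertex x gx≢0)
      ...   | i , eᵢ≡x = trans
        (sum-cong-≗ {N} λ z → cong (_* g x) (𝟙-cong (e-injective ∘ trans eᵢ≡x) (trans (sym eᵢ≡x) ∘ cong e) (x ≟ᵥ e z) (i ≟ z)))
        (∑-𝟙≟-*-sym i (λ _ → g x))

    classSize≡nSize : ∀ k → sum (λ z → 𝟙 (class z ≟ k)) ≡ nSize p b (suc (toℕ k))
    classSize≡nSize k = begin
      sum (λ z → 𝟙 (class z ≟ k))
        ≡⟨ sum-cong-≗ {N} (λ z → 𝟙-cong (Equivalence.to class≡⇔) (Equivalence.from (class≡⇔ {z} {k})) (class z ≟ k) _) ⟩
      sum (λ z → 𝟙 (val (e z) ℕ.≟ suc (toℕ k)))               ≡⟨ ∑-vertices (λ x → 𝟙 (val x ℕ.≟ suc (toℕ k))) vertex-if-nonzero ⟩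
      ∑ᵛ {p} (suc (2 * b)) (λ x → 𝟙 (val x ℕ.≟ suc (toℕ k)))  ≡⟨ ∑ᵛ-𝟙-val {p} (suc (2 * b)) (s≤s (toℕ<n k)) ⟩
      nSize p b (suc (toℕ k))                                 ∎
      where
      open ≡-Reasoning
      vertex-if-nonzero : ∀ x → 𝟙 (val x ℕ.≟ suc (toℕ k)) ≢ 0 → IsVertex p b x
      vertex-if-nonzero x 𝟙≢0 with val x ℕ.≟ suc (toℕ k)
      ... | yes v≡k = val≡⇒IsVertex x v≡k
      ... | no  _   = ⊥-elim (𝟙≢0 refl)

    prodZero?-class : ∀ i j →
      ⌊ prodZero? p b (e i) (e j) ⌋ ≡ ⌊ suc (2 * b) ≤? suc (toℕ (class i)) + suc (toℕ (class j)) ⌋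
    prodZero?-class i j = trans (prodZero?-val p-prime b (e i) (e j))
      (cong (λ v → ⌊ suc (2 * b) ≤? v ⌋) (sym (cong₂ _+_ (suc-class i) (suc-class j))))

    adjMat≡adjacency : ∀ i j → adjMat p b e i j ≡ + (𝟙 (¬? (i ≟ j)) * adjacency b (class i) (class j))
    adjMat≡adjacency i j with i ≟ j
    ... | yes _ = refl
    ... | no  _ = begin
      (if ⌊ prodZero? p b (e i) (e j) ⌋ then + 1 else + 0)
        ≡⟨ cong (λ t → if t then + 1 else + 0) (prodZero?-class i j) ⟩
      (if ⌊ suc (2 * b) ≤? suc (toℕ (class i)) + suc (toℕ (class j)) ⌋ then + 1 else + 0)
        ≡⟨ if-⌊⌋-then-else _ (+ 1) ⟩
      + adjacency b (class i) (class j) *ℤ + 1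
        ≡⟨ ℤ.*-identityʳ _ ⟩
      + adjacency b (class i) (class j)
        ≡⟨ cong +_ (+-identityʳ _) ⟨
      + (adjacency b (class i) (class j) + 0) ∎
      where open ≡-Reasoning

    -- The neighbours of a vertex of valuation t are the other vertices of valuation ≥ 2b + 1 - t.
    degree+self+1 : ∀ i → sum (λ z → 𝟙 (¬? (i ≟ z)) * adjacency b (class i) (class z)) + adjacency b (class i) (class i) + 1
                           ≡ p ^ suc (toℕ (class i))
    degree+self+1 i = begin
      sum (λ z → 𝟙 (¬? (i ≟ z)) * B (class z)) + B (class i) + 1
        ≡⟨ cong (_+ 1) (∑-offDiagonal i (B ∘ class)) ⟩
      sum (B ∘ class) + 1
        ≡⟨ cong (_+ 1) (∑-regroup class B) ⟩
      sum (λ k → B k * sum (λ z → 𝟙 (class z ≟ k))) + 1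
        ≡⟨ cong (_+ 1) (sum-cong-≗ {2 * b} λ k → cong (_*_ (B k)) (classSize≡nSize k)) ⟩
      sum (λ k → B k * nSize p b (suc (toℕ k))) + 1
        ≡⟨ ∑-geometric (≤-trans (s≤s z≤n) (prime⇒2≤ p-prime)) (2 * b) (suc (toℕ (class i))) ⟩
      p ^ (suc (toℕ (class i)) ⊓ (2 * b))
        ≡⟨ cong (p ^_) (m≤n⇒m⊓n≡m (toℕ<n (class i))) ⟩
      p ^ suc (toℕ (class i)) ∎
      where
      open ≡-Reasoning
      B = adjacency b (class i)

    degree : ∀ i → sumZ N (adjMat p b e i) ≡ dDeg p b (suc (toℕ (class i)))
    degree i = begin
      sumZ N (adjMat p b e i)         ≡⟨ sumZ-cong N (adjMat≡adjacency i) ⟩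
      sumZ N (λ z → + deg z)          ≡⟨ sumZ-+ N deg ⟩
      + sum deg                       ≡⟨ by-class (suc (toℕ (class i)) ≤? b) ⟩
      dDeg p b (suc (toℕ (class i)))  ∎
      where
      open ≡-Reasoning
      deg = λ z → 𝟙 (¬? (i ≟ z)) * adjacency b (class i) (class z)
      t = suc (toℕ (class i))
      subtract : ∀ {D B P} → D + B + 1 ≡ P → + D ≡ + P -ℤ + suc B
      subtract {D} {B} refl = sym (begin
        + (D + B + 1) -ℤ + suc B  ≡⟨ cong (λ P → + P -ℤ + suc B) (trans (+-assoc D B 1) (cong (_+_ D) (+-comm B 1))) ⟩
        + (D + suc B) -ℤ + suc B  ≡⟨ ℤ.[+m]-[+n]≡m⊖n (D + suc B) (suc B) ⟩
        (D + suc B) ⊖ suc B       ≡⟨ ℤ.⊖-≥ (m≤n+m (suc B) D) ⟩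
        + (D + suc B ∸ suc B)     ≡⟨ cong +_ (m+n∸n≡m D (suc B)) ⟩
        + D                       ∎)
      by-class : ∀ d → + sum deg ≡ (if ⌊ d ⌋ then + (p ^ t) -ℤ + 1 else + (p ^ t) -ℤ + 2)
      by-class (yes t≤b) =
        subtract (trans (cong (λ B → sum deg + B + 1) (sym (adjacency-diagonal-≤ b (class i) t≤b))) (degree+self+1 i))
      by-class (no  t≰b) =
        subtract (trans (cong (λ B → sum deg + B + 1) (sym (adjacency-diagonal-> b (class i) (≰⇒> t≰b)))) (degree+self+1 i))

    adjMat-diagonal : ∀ i → adjMat p b e i i ≡ + 0
    adjMat-diagonal i = trans (adjMat≡adjacency i i)
      (cong (λ n → + (n * adjacency b (class i) (class i))) (𝟙-no (¬? (i ≟ i)) λ i≢i → i≢i refl))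

    adjMat-offDiagonal : ∀ {i j} → i ≢ j → adjMat p b e i j ≡ + adjacency b (class i) (class j)
    adjMat-offDiagonal {i} {j} i≢j = trans (adjMat≡adjacency i j)
      (cong +_ (trans (cong (_* adjacency b (class i) (class j)) (𝟙-yes (¬? (i ≟ j)) i≢j)) (*-identityˡ _)))

    signlessLap-diagonal : ∀ i → signlessLap p b e i i ≡ dDeg p b (suc (toℕ (class i)))
    signlessLap-diagonal i = trans (cong₂ _+ℤ_ (if-yes (i ≟ i) refl) (adjMat-diagonal i)) (trans (ℤ.+-identityʳ _) (degree i))

    signlessLap-offDiagonal : ∀ {i j} → i ≢ j → signlessLap p b e i j ≡ + adjacency b (class i) (class j)
    signlessLap-offDiagonal {i} {j} i≢j =
      trans (cong (_+ℤ adjMat p b e i j) (if-no (i ≟ j) i≢j)) (trans (ℤ.+-identityˡ _) (adjMat-offDiagonal i≢j))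


module Spectrum {p} (p-prime : Prime p) (b : ℕ) {N} (e : Fin N → Elem p b)
  (e-injective : Injective _≡_ _≡_ e) (e-vertex : ∀ i → IsVertex p b (e i))
  (e-onto : ∀ x → IsVertex p b x → ∃ λ i → e i ≡ x) where

  open import Data.Nat as ℕ using (suc; _∸_; _^_; _<_)
  open import Data.Integer using (ℤ; +_; -_; _+_; _-_)
  import Data.Integer.Properties as ℤ
  import Data.Nat.Properties as ℕ
  open import Data.Integer.Solver using (module +-*-Solver)
  open import Data.Fin using (toℕ; _≟_)
  open import Data.List using (map)
  open import Data.Bool using (if_then_else_; true; false)
  open import Relation.Nullary using (yes; no)
  open import Relation.Nullary.Decidable using (⌊_⌋)
  open import Relation.Binary.PropositionalEquality using (refl; sym; trans; cong; cong₂; _≢_)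
  open PolynomialRing
  open CharacteristicPolynomial
  open ZeroDivisorGraph

  open Enumeration p-prime b e e-injective e-vertex e-onto

  charPoly-byClass : (M : Fin N → Fin N → ℤ) (diagonal : Fin (2 ℕ.* b) → ℤ) (λ₁ λ₂ : ℕ → ℤ) →
    (∀ i → M i i ≡ diagonal (class i)) → (∀ {i j} → i ≢ j → M i j ≡ + adjacency b (class i) (class j)) →
    (∀ k → suc (toℕ k) ≤ b → diagonal k ≡ λ₁ (suc (toℕ k))) →
    (∀ k → b < suc (toℕ k) → diagonal k - + 1 ≡ λ₂ (suc (toℕ k))) →
    charPoly M ≋ prodP (map (λ i → linPow (λ₁ i) (nSize p b i ∸ 1)) (range 1 b))
                 *P prodP (map (λ i → linPow (λ₂ i) (nSize p b i ∸ 1)) (range (suc b) (2 ℕ.* b)))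
                 *P charPoly (λ k l → (if ⌊ k ≟ l ⌋ then diagonal k else + 0) + Qstar p b k l)
  charPoly-byClass M diagonal λ₁ λ₂ M-diagonal M-offDiagonal diagonal≡λ₁ diagonal-1≡λ₂ =
    ≋-trans (charPoly-blockConstant M M-diagonal M-offDiagonal)
            (P.*-cong (∏-ranges b _ _ _ lower upper) (charPoly-cong quotientℤ≡))
    where
    open BlockConstant class class-surjective diagonal (λ k l → + adjacency b k l)
    open +-*-Solver
    lower : ∀ k → suc (toℕ k) ≤ b →
      linPow (eigenvalue k) (classSize class k ∸ 1) ≋ linPow (λ₁ (suc (toℕ k))) (nSize p b (suc (toℕ k)) ∸ 1)
    lower k k<b = ≋-reflexive (cong₂ linPow
      (trans (cong (λ a → diagonal k - + a) (adjacency-diagonal-≤ b k k<b)) (trans (ℤ.+-identityʳ _) (diagonal≡λ₁ k k<b)))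
      (cong (_∸ 1) (classSize≡nSize k)))
    upper : ∀ k → b < suc (toℕ k) →
      linPow (eigenvalue k) (classSize class k ∸ 1) ≋ linPow (λ₂ (suc (toℕ k))) (nSize p b (suc (toℕ k)) ∸ 1)
    upper k b<k = ≋-reflexive (cong₂ linPow
      (trans (cong (λ a → diagonal k - + a) (adjacency-diagonal-> b k b<k)) (diagonal-1≡λ₂ k b<k))
      (cong (_∸ 1) (classSize≡nSize k)))
    quotientℤ≡ : ∀ k l → quotientℤ k l ≡ (if ⌊ k ≟ l ⌋ then diagonal k else + 0) + Qstar p b k l
    quotientℤ≡ k l rewrite classSize≡nSize l with k ≟ l
    ... | no _ = cong (_+_ (+ 0)) (sym (if-⌊⌋-then-else (suc (2 ℕ.* b) ℕ.≤? suc (toℕ k) ℕ.+ suc (toℕ l)) _))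
    ... | yes refl with suc (toℕ k) ℕ.≤? b
    ...   | yes k<b rewrite adjacency-diagonal-≤ b k k<b = ℤ.+-identityʳ _
    ...   | no  k≮b rewrite adjacency-diagonal-> b k (ℕ.≰⇒> k≮b) =
      solve 2 (λ d n → (d :- con (+ 1)) :+ con (+ 1) :* n := d :+ (n :- con (+ 1))) refl (diagonal k) (+ nSize p b (suc (toℕ k)))

  adjacency-spectrum : charPoly (adjMat p b e) ≋ adjSpecPoly p b
  adjacency-spectrum = ≋-trans
    (charPoly-byClass (adjMat p b e) (λ _ → + 0) (λ _ → + 0) (λ _ → - + 1)
      adjMat-diagonal adjMat-offDiagonal (λ _ _ → refl) (λ _ _ → refl))
    (*P-congʳ (prodP (map (λ i → linPow (+ 0) (nSize p b i ∸ 1)) (range 1 b))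
               *P prodP (map (λ i → linPow (- + 1) (nSize p b i ∸ 1)) (range (suc b) (2 ℕ.* b))))
              (charPoly-cong zero-diagonal))
    where
    zero-diagonal : ∀ k l → (if ⌊ k ≟ l ⌋ then + 0 else + 0) + Qstar p b k l ≡ Qstar p b k l
    zero-diagonal k l with ⌊ k ≟ l ⌋
    ... | true  = ℤ.+-identityˡ _
    ... | false = ℤ.+-identityˡ _

  signlessLaplacian-spectrum : charPoly (signlessLap p b e) ≋ qSpecPoly p b
  signlessLaplacian-spectrum =
    charPoly-byClass (signlessLap p b e) (λ k → dDeg p b (suc (toℕ k))) (λ i → + (p ^ i) - + 1) (λ i → + (p ^ i) - + 3)
      signlessLap-diagonal signlessLap-offDiagonal lower upper
    where
    lower : ∀ k → suc (toℕ k) ≤ b → dDeg p b (suc (toℕ k)) ≡ + (p ^ suc (toℕ k)) - + 1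
    lower k k<b = if-yes (suc (toℕ k) ℕ.≤? b) k<b
    upper : ∀ k → b < suc (toℕ k) → dDeg p b (suc (toℕ k)) - + 1 ≡ + (p ^ suc (toℕ k)) - + 3
    upper k b<k =
      trans (cong (_- + 1) (if-no (suc (toℕ k) ℕ.≤? b) (ℕ.<⇒≱ b<k))) (ℤ.+-assoc (+ (p ^ suc (toℕ k))) (- + 2) (- + 1))


-- For b = 0 there are no vertices and both sides are 1.
corollary3p4 : (p : ℕ) → Prime p → (b : ℕ) → 1 ≤ b →
    (N : ℕ) (e : Fin N → Elem p b) →
    Injective _≡_ _≡_ e →
    (∀ i → IsVertex p b (e i)) →
    (∀ x → IsVertex p b x → ∃ λ i → e i ≡ x) →
    (charPoly (adjMat p b e) ≈P adjSpecPoly p b)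
      × (charPoly (signlessLap p b e) ≈P qSpecPoly p b)
corollary3p4 p p-prime b _ N e e-injective e-vertex e-onto =
  coeff-≡ adjacency-spectrum , coeff-≡ signlessLaplacian-spectrum
  where
  open PolynomialRing using (coeff-≡)
  open Spectrum p-prime b e e-injective e-vertex e-onto
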